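{- For $|q|<1$, $$\begin{aligned}\varphi(q)\varphi(q^3)&=\varphi(q^{16})\varphi(q^{48})+4q^{16}\psi(q^{32})\psi(q^{96})+2q\,\varphi(q^{48})\psi(q^8)+2q^3\varphi(q^{16})\psi(q^{24})\\&\quad+6q^4\psi(q^8)\psi(q^{24})+4q^{13}\psi(q^8)\psi(q^{96})+4q^7\psi(q^{24})\psi(q^{32}).\end{aligned}$$
   Context: Ramanujan's theta functions are $\varphi(q)=\sum_{n=-\infty}^{\infty}q^{n^2}$ and $\psi(q)=\sum_{n=0}^{\infty}q^{n(n+1)/2}$ for $|q|<1$. -}

module Defs where

open import Data.Nat using (ℕ; zero; suc; _+_; _*_; _∸_; _≤ᵇ_)
import Data.Nat as ℕ
open import Data.Integer using (ℤ; +_)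
import Data.Integer as ℤ
open import Data.Bool using (Bool; if_then_else_)
open import Relation.Nullary.Decidable using (⌊_⌋)

-- Formal power series in q with natural-number coefficients:
-- a series is its coefficient function n ↦ [q^n] f.
Series : Set
Series = ℕ → ℕ

sumTo : ℕ → (ℕ → ℕ) → ℕ
sumTo zero    f = f 0
sumTo (suc n) f = sumTo n f + f (suc n)

ind : Bool → ℕ
ind b = if b then 1 else 0

-- φ(q) = Σ_{m ∈ ℤ} q^{m²}: coefficient of q^N counts m ∈ ℤ with m² = N;
-- every such m satisfies -N ≤ m ≤ N, so we sum over m = i - N, 0 ≤ i ≤ 2N.
φ : Series
φ N = sumTo (2 * N) λ i →
  ind ⌊ ((+ i) ℤ.- (+ N)) ℤ.* ((+ i) ℤ.- (+ N)) ℤ.≟ (+ N) ⌋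

-- ψ(q) = Σ_{n ≥ 0} q^{n(n+1)/2}: coefficient of q^N counts n ≥ 0 with
-- n(n+1)/2 = N (i.e. n(n+1) = 2N); every such n satisfies n ≤ N.
ψ : Series
ψ N = sumTo N λ n → ind ⌊ n * suc n ℕ.≟ 2 * N ⌋

-- f(q^k): coefficient of q^n is Σ_{m ≤ n, k m = n} [q^m] f
dil : ℕ → Series → Series
dil k f n = sumTo n λ m → ind ⌊ k * m ℕ.≟ n ⌋ * f m

shift : ℕ → Series → Series
shift s f n = if s ≤ᵇ n then f (n ∸ s) else 0

infixl 7 _⊛_
_⊛_ : Series → Series → Series
(f ⊛ g) n = sumTo n λ k → f k * g (n ∸ k)

infixl 6 _⊕_
_⊕_ : Series → Series → Series
(f ⊕ g) n = f n + g n

infixr 8 _·_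
_·_ : ℕ → Series → Series
(c · f) n = c * f n

-- The coefficient of qⁿ on the left counts pairs (a , b) ∈ ℤ² with a² + 3b² = n.
-- Sort a and b into the classes a ≡ 0 (mod 4), a ≡ 2 (mod 4), a odd, on which
-- a² equals 16x², 32·T(x) + 4 and 8·T(x) + 1 respectively (T(x) = x(x+1)/2,
-- a triangular number, each of which arises from exactly two integers x).
-- Seven of the nine class pairs are then, by a change of variables, the
-- counts read off from the seven products on the right.  The two remaining
-- class pairs (0,2) and (2,0) together contribute half of the (odd,odd)
-- count: with a = 2σ, b = 2τ the substitution (σ , τ) ↦ (σ + 3τ , ±(σ − τ))
-- preserves a² + 3b² and maps them onto the odd pairs (u , v) with
-- u ≡ ±v (mod 4).  This turns 4·[ψ(q⁸)ψ(q²⁴)] into the coefficient 6.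
module Submission where

open import Defs
open import Data.Nat using (ℕ; zero; suc; _+_; _*_; _∸_; _≤_; _<_; z≤n; s≤s; _≤ᵇ_; NonZero)
import Data.Nat as ℕ
import Data.Nat.Properties as ℕP
open import Data.Integer using (ℤ; +_; -[1+_])
import Data.Integer as ℤ
import Data.Integer.Properties as ℤP
import Data.Integer.DivMod as ℤD
open import Data.Bool using (true; false)
open import Data.List using (List; []; _∷_; _++_; map)
open import Data.Product using (Σ; _×_; _,_; proj₁; proj₂)
open import Data.Sum using (inj₁; inj₂)
open import Relation.Nullary using (¬_; Dec; yes; no; ofʸ; ofⁿ)
open import Relation.Nullary.Decidable using (⌊_⌋)
open import Relation.Binary.PropositionalEquality
open import Data.Empty using (⊥-elim)
open import Function using (_∘_)
open import Data.Integer.Tactic.RingSolver using (solve-∀)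
import Data.Nat.Tactic.RingSolver as ℕ-Ring
open import Algebra.Properties.CommutativeSemigroup ℕP.+-commutativeSemigroup using (interchange)
open import Algebra.Properties.CommutativeSemigroup ℕP.*-commutativeSemigroup using (x∙yz≈y∙xz)
open import Algebra.Properties.AbelianGroup ℤP.+-0-abelianGroup using () renaming (∙-cancelˡ to ℤ+-cancelˡ)

ind-yes : ∀ {P : Set} (d : Dec P) → P → ind ⌊ d ⌋ ≡ 1
ind-yes (yes _) _ = refl
ind-yes (no ¬p) p = ⊥-elim (¬p p)

ind-no : ∀ {P : Set} (d : Dec P) → ¬ P → ind ⌊ d ⌋ ≡ 0
ind-no (yes p) ¬p = ⊥-elim (¬p p)
ind-no (no _) _ = refl

ind-nz : ∀ {P : Set} (d : Dec P) → ind ⌊ d ⌋ ≢ 0 → P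
ind-nz (yes p) _ = p
ind-nz (no _) h = ⊥-elim (h refl)

ind-iff : ∀ {P Q : Set} (d : Dec P) (e : Dec Q) → (P → Q) → (Q → P) → ind ⌊ d ⌋ ≡ ind ⌊ e ⌋
ind-iff (yes p) (yes q) f g = refl
ind-iff (yes p) (no ¬q) f g = ⊥-elim (¬q (f p))
ind-iff (no ¬p) (yes q) f g = ⊥-elim (¬p (g q))
ind-iff (no ¬p) (no ¬q) f g = refl

nz*ˡ : ∀ a b → a * b ≢ 0 → a ≢ 0
nz*ˡ a b nz e = nz (cong (_* b) e)

nz*ʳ : ∀ a b → a * b ≢ 0 → b ≢ 0
nz*ʳ a b nz e = nz (trans (cong (a *_) e) (ℕP.*-zeroʳ a))

nz-cross : ∀ a b c d → a * b + c * d ≢ 0 → (a + c ≢ 0) × (b + d ≢ 0)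
nz-cross a b c d nz =
  (λ e → nz (cong₂ _+_ (cong (_* b) (ℕP.m+n≡0⇒m≡0 a e)) (cong (_* d) (ℕP.m+n≡0⇒n≡0 a e))))
  , (λ e → nz (cong₂ _+_ (trans (cong (a *_) (ℕP.m+n≡0⇒m≡0 b e)) (ℕP.*-zeroʳ a))
                         (trans (cong (c *_) (ℕP.m+n≡0⇒n≡0 b e)) (ℕP.*-zeroʳ c))))

lsum : {A : Set} → List A → (A → ℕ) → ℕ
lsum [] f = 0
lsum (x ∷ xs) f = f x + lsum xs f

module _ {A : Set} where
  lsum-ext : (xs : List A) {f g : A → ℕ} → (∀ x → f x ≡ g x) → lsum xs f ≡ lsum xs g
  lsum-ext [] h = refl
  lsum-ext (x ∷ xs) h = cong₂ _+_ (h x) (lsum-ext xs h)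

  lsum-+ : (xs : List A) (f g : A → ℕ) → lsum xs (λ x → f x + g x) ≡ lsum xs f + lsum xs g
  lsum-+ [] f g = refl
  lsum-+ (x ∷ xs) f g =
    trans (cong (λ t → f x + g x + t) (lsum-+ xs f g)) (interchange (f x) (g x) (lsum xs f) (lsum xs g))

  lsum-*ˡ : (xs : List A) (c : ℕ) (f : A → ℕ) → lsum xs (λ x → c * f x) ≡ c * lsum xs f
  lsum-*ˡ [] c f = sym (ℕP.*-zeroʳ c)
  lsum-*ˡ (x ∷ xs) c f =
    trans (cong (λ t → c * f x + t) (lsum-*ˡ xs c f)) (sym (ℕP.*-distribˡ-+ c (f x) (lsum xs f)))

  lsum-*ʳ : (xs : List A) (c : ℕ) (f : A → ℕ) → lsum xs (λ x → f x * c) ≡ lsum xs f * c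
  lsum-*ʳ xs c f = trans (lsum-ext xs (λ x → ℕP.*-comm (f x) c))
                         (trans (lsum-*ˡ xs c f) (ℕP.*-comm c (lsum xs f)))

  lsum-0 : (xs : List A) (f : A → ℕ) → (∀ x → f x ≡ 0) → lsum xs f ≡ 0
  lsum-0 [] f h = refl
  lsum-0 (x ∷ xs) f h = cong₂ _+_ (h x) (lsum-0 xs f h)

  lsum-++ : (xs ys : List A) (f : A → ℕ) → lsum (xs ++ ys) f ≡ lsum xs f + lsum ys f
  lsum-++ [] ys f = refl
  lsum-++ (x ∷ xs) ys f = trans (cong (λ t → f x + t) (lsum-++ xs ys f)) (sym (ℕP.+-assoc (f x) _ _))

  lsum-map : {B : Set} (g : B → A) (xs : List B) (f : A → ℕ) → lsum (map g xs) f ≡ lsum xs (f ∘ g)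
  lsum-map g [] f = refl
  lsum-map g (x ∷ xs) f = cong (λ t → f (g x) + t) (lsum-map g xs f)

lsum-swap : {A B : Set} (xs : List A) (ys : List B) (h : A → B → ℕ) →
  lsum xs (λ x → lsum ys (h x)) ≡ lsum ys (λ y → lsum xs (λ x → h x y))
lsum-swap [] ys h = sym (lsum-0 ys _ (λ _ → refl))
lsum-swap (x ∷ xs) ys h =
  trans (cong (λ t → lsum ys (h x) + t) (lsum-swap xs ys h)) (sym (lsum-+ ys (h x) _))

pairs : {A B : Set} → List A → List B → List (A × B)
pairs [] ys = []
pairs (x ∷ xs) ys = map (x ,_) ys ++ pairs xs ys

lsum-pairs : {A B : Set} (xs : List A) (ys : List B) (h : A × B → ℕ) →
  lsum (pairs xs ys) h ≡ lsum xs (λ x → lsum ys (λ y → h (x , y)))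
lsum-pairs [] ys h = refl
lsum-pairs (x ∷ xs) ys h = trans (lsum-++ (map (x ,_) ys) (pairs xs ys) h)
  (cong₂ _+_ (lsum-map (x ,_) ys h) (lsum-pairs xs ys h))

-- An enumeration of a region `In` of a type with decidable equality: a list
-- on which summing against a Kronecker delta δ_a picks out the value at a
-- exactly when a lies in the region (each point of the region is listed
-- once, no other point is listed).
record Enumeration (A : Set) : Set₁ where
  field
    elems : List A
    In    : A → Set
    In?   : (a : A) → Dec (In a)
    eq?   : (a b : A) → Dec (a ≡ b)
    δ-in  : ∀ a (h : A → ℕ) → In a → lsum elems (λ x → ind ⌊ eq? a x ⌋ * h x) ≡ h a
    δ-out : ∀ a (h : A → ℕ) → ¬ In a → lsum elems (λ x → ind ⌊ eq? a x ⌋ * h x) ≡ 0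
open Enumeration

-- Both sides equal the double sum Σ_{i,j} [g j = i] q j.
sum-reindex : {A B : Set} (EI : Enumeration A) (EJ : Enumeration B) (p : A → ℕ) (q : B → ℕ) (g : B → A) →
  (∀ j → q j ≡ p (g j)) → (∀ j j' → g j ≡ g j' → j ≡ j') →
  (∀ i → p i ≢ 0 → Σ B λ j → g j ≡ i) →
  (∀ i → p i ≢ 0 → In EI i) → (∀ j → q j ≢ 0 → In EJ j) →
  lsum (elems EI) p ≡ lsum (elems EJ) q
sum-reindex {A} {B} EI EJ p q g q≡p∘g inj onto inI inJ =
  trans (lsum-ext (elems EI) p-as-sum)
  (trans (lsum-swap (elems EI) (elems EJ) _)
  (lsum-ext (elems EJ) q-as-sum))
  where
  δ-transport : ∀ i j₀ → g j₀ ≡ i → ∀ j → ind ⌊ eq? EI (g j) i ⌋ * q j ≡ ind ⌊ eq? EJ j₀ j ⌋ * q j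
  δ-transport i j₀ e₀ j with eq? EI (g j) i | eq? EJ j₀ j
  ... | yes e | yes _  = refl
  ... | yes e | no ne  = ⊥-elim (ne (inj j₀ j (trans e₀ (sym e))))
  ... | no ne | yes e' = ⊥-elim (ne (trans (cong g (sym e')) e₀))
  ... | no _  | no _   = refl

  p-as-sum : ∀ i → p i ≡ lsum (elems EJ) (λ j → ind ⌊ eq? EI (g j) i ⌋ * q j)
  p-as-sum i with p i ℕ.≟ 0
  ... | yes pi≡0 = trans pi≡0 (sym (lsum-0 (elems EJ) _ vanish))
    where vanish : ∀ j → ind ⌊ eq? EI (g j) i ⌋ * q j ≡ 0
          vanish j with eq? EI (g j) i
          ... | yes e = trans (ℕP.+-identityʳ (q j)) (trans (q≡p∘g j) (trans (cong p e) pi≡0))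
          ... | no _  = refl
  ... | no pi≢0 =
    let (j₀ , e₀) = onto i pi≢0
        qj₀ = trans (q≡p∘g j₀) (cong p e₀) in
    sym (trans (lsum-ext (elems EJ) (δ-transport i j₀ e₀))
               (trans (δ-in EJ j₀ q (inJ j₀ (λ z → pi≢0 (trans (sym qj₀) z)))) qj₀))

  q-as-sum : ∀ j → lsum (elems EI) (λ i → ind ⌊ eq? EI (g j) i ⌋ * q j) ≡ q j
  q-as-sum j with In? EI (g j)
  ... | yes gj∈I = δ-in EI (g j) (λ _ → q j) gj∈I
  ... | no gj∉I with q j ℕ.≟ 0
  ...   | yes qj≡0 = trans (δ-out EI (g j) (λ _ → q j) gj∉I) (sym qj≡0)
  ...   | no qj≢0  = ⊥-elim (gj∉I (inI (g j) (λ z → qj≢0 (trans (q≡p∘g j) z))))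

range : ℕ → List ℕ
range zero = 0 ∷ []
range (suc n) = range n ++ (suc n ∷ [])

lsum-range-suc : ∀ n f → lsum (range (suc n)) f ≡ lsum (range n) f + f (suc n)
lsum-range-suc n f = trans (lsum-++ (range n) (suc n ∷ []) f) (cong (λ t → lsum (range n) f + t) (ℕP.+-identityʳ _))

sumTo-lsum : ∀ n f → sumTo n f ≡ lsum (range n) f
sumTo-lsum zero f = sym (ℕP.+-identityʳ (f 0))
sumTo-lsum (suc n) f = trans (cong (_+ f (suc n)) (sumTo-lsum n f)) (sym (lsum-range-suc n f))

range-δ-out : ∀ n a (h : ℕ → ℕ) → ¬ a ≤ n → lsum (range n) (λ x → ind ⌊ a ℕ.≟ x ⌋ * h x) ≡ 0
range-δ-out zero a h a≰0 = cong (λ t → t * h 0 + 0) (ind-no (a ℕ.≟ 0) (λ { refl → a≰0 z≤n }))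
range-δ-out (suc n) a h a≰1+n = trans (lsum-range-suc n _)
  (cong₂ _+_ (range-δ-out n a h (λ a≤n → a≰1+n (ℕP.m≤n⇒m≤1+n a≤n)))
             (cong (_* h (suc n)) (ind-no (a ℕ.≟ suc n) (λ { refl → a≰1+n ℕP.≤-refl }))))

range-δ-in : ∀ n a (h : ℕ → ℕ) → a ≤ n → lsum (range n) (λ x → ind ⌊ a ℕ.≟ x ⌋ * h x) ≡ h a
range-δ-in zero .zero h z≤n = trans (ℕP.+-identityʳ _) (ℕP.+-identityʳ (h 0))
range-δ-in (suc n) a h a≤1+n with a ℕ.≤? n
... | yes a≤n = trans (lsum-range-suc n _)
  (trans (cong₂ _+_ (range-δ-in n a h a≤n)
                    (cong (_* h (suc n)) (ind-no (a ℕ.≟ suc n) (λ { refl → ℕP.<-irrefl refl a≤n }))))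
         (ℕP.+-identityʳ (h a)))
... | no a≰n with ℕP.≤-antisym a≤1+n (ℕP.≰⇒> a≰n)
...   | refl = trans (lsum-range-suc n _)
  (trans (cong₂ _+_ (range-δ-out n a h a≰n) (cong (_* h a) (ind-yes (a ℕ.≟ a) refl)))
         (ℕP.+-identityʳ (h a)))

rangeE : ℕ → Enumeration ℕ
rangeE n = record
  { elems = range n ; In = _≤ n ; In? = ℕ._≤? n ; eq? = ℕ._≟_
  ; δ-in = λ a h → range-δ-in n a h ; δ-out = λ a h → range-δ-out n a h }

range-ext : ∀ n (f g : ℕ → ℕ) → (∀ i → i ≤ n → f i ≡ g i) → lsum (range n) f ≡ lsum (range n) g
range-ext zero f g h = cong (_+ 0) (h 0 z≤n)
range-ext (suc n) f g h = trans (lsum-range-suc n f) (trans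
  (cong₂ _+_ (range-ext n f g (λ i i≤n → h i (ℕP.m≤n⇒m≤1+n i≤n))) (h (suc n) ℕP.≤-refl))
  (sym (lsum-range-suc n g)))

range-extend : ∀ m k (f : ℕ → ℕ) → (∀ i → m < i → f i ≡ 0) → lsum (range (m + k)) f ≡ lsum (range m) f
range-extend m zero f h = cong (λ t → lsum (range t) f) (ℕP.+-identityʳ m)
range-extend m (suc k) f h rewrite ℕP.+-suc m k =
  trans (lsum-range-suc (m + k) f)
  (trans (cong₂ _+_ (range-extend m k f h) (h (suc (m + k)) (s≤s (ℕP.m≤m+n m k))))
   (ℕP.+-identityʳ _))

-- The box [-(B+1) , B] of ℤ, listed as its non-negative and negative halves.

InZ : ℕ → ℤ → Set
InZ B (+ n) = n ≤ B
InZ B -[1+ n ] = n ≤ B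

InZ? : ∀ B z → Dec (InZ B z)
InZ? B (+ n) = n ℕ.≤? B
InZ? B -[1+ n ] = n ℕ.≤? B

-- the constructor + as an ordinary function (sections of +_ would clash with ℕ addition)
pos : ℕ → ℤ
pos n = + n

zl : ℕ → List ℤ
zl B = map pos (range B) ++ map -[1+_] (range B)

lsum-zl : ∀ B (F : ℤ → ℕ) → lsum (zl B) F ≡ lsum (range B) (λ i → F (+ i)) + lsum (range B) (λ i → F -[1+ i ])
lsum-zl B F = trans (lsum-++ (map pos (range B)) _ F) (cong₂ _+_ (lsum-map pos (range B) F) (lsum-map -[1+_] (range B) F))

δ-pos : ∀ B m (h : ℤ → ℕ) →
  lsum (range B) (λ x → ind ⌊ + m ℤP.≟ + x ⌋ * h (+ x)) ≡ lsum (range B) (λ x → ind ⌊ m ℕ.≟ x ⌋ * h (+ x))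
δ-pos B m h = lsum-ext (range B) (λ x → cong (_* h (+ x)) (ind-iff (+ m ℤP.≟ + x) (m ℕ.≟ x) ℤP.+-injective (cong pos)))

δ-neg : ∀ B m (h : ℤ → ℕ) →
  lsum (range B) (λ x → ind ⌊ -[1+ m ] ℤP.≟ -[1+ x ] ⌋ * h -[1+ x ]) ≡
  lsum (range B) (λ x → ind ⌊ m ℕ.≟ x ⌋ * h -[1+ x ])
δ-neg B m h = lsum-ext (range B) (λ x → cong (_* h -[1+ x ])
  (ind-iff (-[1+ m ] ℤP.≟ -[1+ x ]) (m ℕ.≟ x) ℤP.-[1+-injective (cong -[1+_])))

δ-pos-neg : ∀ B m (h : ℤ → ℕ) → lsum (range B) (λ x → ind ⌊ + m ℤP.≟ -[1+ x ] ⌋ * h -[1+ x ]) ≡ 0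
δ-pos-neg B m h = lsum-0 (range B) _ (λ x → cong (_* h -[1+ x ]) (ind-no (+ m ℤP.≟ -[1+ x ]) (λ ())))

δ-neg-pos : ∀ B m (h : ℤ → ℕ) → lsum (range B) (λ x → ind ⌊ -[1+ m ] ℤP.≟ + x ⌋ * h (+ x)) ≡ 0
δ-neg-pos B m h = lsum-0 (range B) _ (λ x → cong (_* h (+ x)) (ind-no (-[1+ m ] ℤP.≟ + x) (λ ())))

zδ-in : ∀ B a (h : ℤ → ℕ) → InZ B a → lsum (zl B) (λ x → ind ⌊ a ℤP.≟ x ⌋ * h x) ≡ h a
zδ-in B (+ m) h m≤B = trans (lsum-zl B _)
  (trans (cong₂ _+_ (trans (δ-pos B m h) (range-δ-in B m (h ∘ pos) m≤B)) (δ-pos-neg B m h)) (ℕP.+-identityʳ _))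
zδ-in B -[1+ m ] h m≤B = trans (lsum-zl B _)
  (cong₂ _+_ (δ-neg-pos B m h) (trans (δ-neg B m h) (range-δ-in B m (h ∘ -[1+_]) m≤B)))

zδ-out : ∀ B a (h : ℤ → ℕ) → ¬ InZ B a → lsum (zl B) (λ x → ind ⌊ a ℤP.≟ x ⌋ * h x) ≡ 0
zδ-out B (+ m) h m≰B = trans (lsum-zl B _)
  (cong₂ _+_ (trans (δ-pos B m h) (range-δ-out B m (h ∘ pos) m≰B)) (δ-pos-neg B m h))
zδ-out B -[1+ m ] h m≰B = trans (lsum-zl B _)
  (cong₂ _+_ (δ-neg-pos B m h) (trans (δ-neg B m h) (range-δ-out B m (h ∘ -[1+_]) m≰B)))

zE : ℕ → Enumeration ℤ
zE B = record { elems = zl B ; In = InZ B ; In? = InZ? B ; eq? = ℤP._≟_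
  ; δ-in = zδ-in B ; δ-out = zδ-out B }

pair-eq? : {A B : Set} → ((a b : A) → Dec (a ≡ b)) → ((a b : B) → Dec (a ≡ b)) → (x y : A × B) → Dec (x ≡ y)
pair-eq? dA dB (a , b) (c , d) with dA a c | dB b d
... | yes refl | yes refl = yes refl
... | no ne | _ = no (λ e → ne (cong proj₁ e))
... | yes _ | no ne = no (λ e → ne (cong proj₂ e))

pair-ind : {A B : Set} (dA : (a b : A) → Dec (a ≡ b)) (dB : (a b : B) → Dec (a ≡ b)) (a c : A) (b d : B) →
  ind ⌊ pair-eq? dA dB (a , b) (c , d) ⌋ ≡ ind ⌊ dA a c ⌋ * ind ⌊ dB b d ⌋
pair-ind dA dB a c b d with dA a c | dB b d
... | yes refl | yes refl = refl
... | no ne | _ = refl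
... | yes refl | no ne = refl

dec-× : ∀ {P Q : Set} → Dec P → Dec Q → Dec (P × Q)
dec-× (yes p) (yes q) = yes (p , q)
dec-× (no ¬p) _ = no (λ z → ¬p (proj₁ z))
dec-× (yes _) (no ¬q) = no (λ z → ¬q (proj₂ z))

module _ {A B : Set} (EA : Enumeration A) (EB : Enumeration B) where
  private
    eq×? = pair-eq? (eq? EA) (eq? EB)

    δ-inner : ∀ a b (h : A × B → ℕ) x →
      lsum (elems EB) (λ y → ind ⌊ eq×? (a , b) (x , y) ⌋ * h (x , y)) ≡
      ind ⌊ eq? EA a x ⌋ * lsum (elems EB) (λ y → ind ⌊ eq? EB b y ⌋ * h (x , y))
    δ-inner a b h x =
      trans (lsum-ext (elems EB) (λ y → trans (cong (_* h (x , y)) (pair-ind (eq? EA) (eq? EB) a x b y))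
                                              (ℕP.*-assoc (ind ⌊ eq? EA a x ⌋) _ _)))
            (lsum-*ˡ (elems EB) (ind ⌊ eq? EA a x ⌋) _)

    δ×-in : ∀ a b (h : A × B → ℕ) → In EA a → In EB b →
      lsum (pairs (elems EA) (elems EB)) (λ x → ind ⌊ eq×? (a , b) x ⌋ * h x) ≡ h (a , b)
    δ×-in a b h a∈ b∈ = trans (lsum-pairs (elems EA) (elems EB) _)
      (trans (lsum-ext (elems EA) (λ x → trans (δ-inner a b h x)
                 (cong (ind ⌊ eq? EA a x ⌋ *_) (δ-in EB b (λ y → h (x , y)) b∈))))
             (δ-in EA a (λ x → h (x , b)) a∈))

    δ×-out : ∀ a b (h : A × B → ℕ) → ¬ (In EA a × In EB b) →
      lsum (pairs (elems EA) (elems EB)) (λ x → ind ⌊ eq×? (a , b) x ⌋ * h x) ≡ 0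
    δ×-out a b h ab∉ = trans (lsum-pairs (elems EA) (elems EB) _)
      (trans (lsum-ext (elems EA) (δ-inner a b h)) outside)
      where
      outside : lsum (elems EA) (λ x → ind ⌊ eq? EA a x ⌋ * lsum (elems EB) (λ y → ind ⌊ eq? EB b y ⌋ * h (x , y))) ≡ 0
      outside with In? EA a | In? EB b
      ... | no a∉ | _ = δ-out EA a _ a∉
      ... | yes _ | no b∉ = trans (lsum-ext (elems EA) (λ x → cong (ind ⌊ eq? EA a x ⌋ *_) (δ-out EB b _ b∉)))
                                  (lsum-0 (elems EA) _ (λ x → ℕP.*-zeroʳ (ind ⌊ eq? EA a x ⌋)))
      ... | yes a∈ | yes b∈ = ⊥-elim (ab∉ (a∈ , b∈))

  pairE : Enumeration (A × B)
  pairE = record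
    { elems = pairs (elems EA) (elems EB)
    ; In = λ { (a , b) → In EA a × In EB b }
    ; In? = λ { (a , b) → dec-× (In? EA a) (In? EB b) }
    ; eq? = eq×?
    ; δ-in = λ { (a , b) h (a∈ , b∈) → δ×-in a b h a∈ b∈ }
    ; δ-out = λ { (a , b) h → δ×-out a b h }
    }

S : ℤ → ℕ
S z = ℤ.∣ z ∣ * ℤ.∣ z ∣

tri : ℕ → ℕ
tri zero = zero
tri (suc n) = suc n + tri n

-- T x = x(x+1)/2; note T (-1-x) = T x, so each triangular number has two preimages.
T : ℤ → ℕ
T (+ n) = tri n
T -[1+ n ] = tri n

S-square : ∀ z → + S z ≡ z ℤ.* z
S-square (+ n) = sym (ℤP.+◃n≡+n (n * n))
S-square -[1+ n ] = sym (ℤP.+◃n≡+n (suc n * suc n))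

tri-double : ∀ n → 2 * tri n ≡ n * suc n
tri-double zero = refl
tri-double (suc n) = begin
  2 * (suc n + tri n)        ≡⟨ ℕP.*-distribˡ-+ 2 (suc n) (tri n) ⟩
  2 * suc n + 2 * tri n      ≡⟨ cong (λ t → 2 * suc n + t) (tri-double n) ⟩
  2 * suc n + n * suc n      ≡⟨ step n ⟩
  suc n * suc (suc n)        ∎
  where
  open ≡-Reasoning
  step : ∀ n → 2 * suc n + n * suc n ≡ suc n * suc (suc n)
  step = ℕ-Ring.solve-∀

T-double : ∀ x → + 2 ℤ.* + T x ≡ x ℤ.* (x ℤ.+ + 1)
T-double (+ n) = trans (sym (ℤP.pos-* 2 (tri n))) (trans (cong pos (tri-double n))
  (trans (ℤP.pos-* n (suc n)) (cong (λ t → + n ℤ.* + t) (ℕP.+-comm 1 n))))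
T-double -[1+ n ] = trans (T-double (+ n)) (trans (sym (reflect (+ n)))
  (cong (λ t → (ℤ.- t) ℤ.* ((ℤ.- t) ℤ.+ + 1)) (cong pos (ℕP.+-comm n 1))))
  where
  reflect : ∀ y → (ℤ.- (y ℤ.+ + 1)) ℤ.* ((ℤ.- (y ℤ.+ + 1)) ℤ.+ + 1) ≡ y ℤ.* (y ℤ.+ + 1)
  reflect = solve-∀

n≤n*n : ∀ n → n ≤ n * n
n≤n*n zero = z≤n
n≤n*n (suc n) = ℕP.m≤m*n (suc n) (suc n)

n≤tri : ∀ n → n ≤ tri n
n≤tri zero = z≤n
n≤tri (suc n) = ℕP.m≤m+n (suc n) (tri n)

inZ-S : ∀ {B} z → S z ≤ B → InZ B z
inZ-S (+ n) le = ℕP.≤-trans (n≤n*n n) le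
inZ-S -[1+ n ] le = ℕP.≤-trans (ℕP.n≤1+n n) (ℕP.≤-trans (n≤n*n (suc n)) le)

inZ-T : ∀ {B} z → T z ≤ B → InZ B z
inZ-T (+ n) le = ℕP.≤-trans (n≤tri n) le
inZ-T -[1+ n ] le = ℕP.≤-trans (n≤tri n) le

-- Series as counting functions.  `count B e m` counts z in the box of size B
-- with e z = m, and f "counts e" when its m-th coefficient is that number for
-- every box containing [-m , m]; similarly for pairs.

count : ℕ → (ℤ → ℕ) → ℕ → ℕ
count B e m = lsum (zl B) (λ z → ind ⌊ e z ℕ.≟ m ⌋)

count2 : ℕ → (ℤ → ℤ → ℕ) → ℕ → ℕ
count2 B E m = lsum (zl B) (λ z → lsum (zl B) (λ w → ind ⌊ E z w ℕ.≟ m ⌋))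

IsCount : (ℤ → ℕ) → Series → Set
IsCount e f = ∀ m B → m ≤ B → f m ≡ count B e m

IsCount2 : (ℤ → ℤ → ℕ) → Series → Set
IsCount2 E F = ∀ m B → m ≤ B → F m ≡ count2 B E m

-- φ counts the squares: the summation index i of φ corresponds to z = i - m.
φ-count : IsCount S φ
φ-count m B m≤B = trans (sumTo-lsum (2 * m) _)
  (sym (sum-reindex (zE B) (rangeE (2 * m)) p q g q≡p∘g g-inj g-onto p-supp q-supp))
  where
  p : ℤ → ℕ
  p z = ind ⌊ S z ℕ.≟ m ⌋
  g : ℕ → ℤ
  g i = pos i ℤ.- pos m
  q : ℕ → ℕ
  q i = ind ⌊ g i ℤ.* g i ℤ.≟ pos m ⌋

  add-sub : ∀ x y → x ℤ.+ y ℤ.- y ≡ x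
  add-sub = solve-∀
  sub-add : ∀ x y → x ℤ.- y ℤ.+ y ≡ x
  sub-add = solve-∀
  sub-sum : ∀ x y → x ℤ.- (x ℤ.+ y) ≡ ℤ.- y
  sub-sum = solve-∀

  q≡p∘g : ∀ i → q i ≡ p (g i)
  q≡p∘g i = ind-iff _ _ (λ e → ℤP.+-injective (trans (S-square (g i)) e))
                        (λ e → trans (sym (S-square (g i))) (cong pos e))

  g-inj : ∀ i j → g i ≡ g j → i ≡ j
  g-inj i j e = ℤP.+-injective (trans (sym (sub-add (pos i) (pos m)))
                                      (trans (cong (ℤ._+ pos m) e) (sub-add (pos j) (pos m))))

  g-onto : ∀ z → p z ≢ 0 → Σ ℕ λ i → g i ≡ z
  g-onto (+ k) _ = k + m , add-sub (pos k) (pos m)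
  g-onto -[1+ k ] nz = m ∸ suc k ,
      trans (cong (λ t → pos (m ∸ suc k) ℤ.- pos t) (sym m∸k+k≡m)) (sub-sum (pos (m ∸ suc k)) (pos (suc k)))
    where m∸k+k≡m : m ∸ suc k + suc k ≡ m
          m∸k+k≡m = ℕP.m∸n+n≡m (subst (suc k ≤_) (ind-nz (S -[1+ k ] ℕ.≟ m) nz) (n≤n*n (suc k)))

  p-supp : ∀ z → p z ≢ 0 → InZ B z
  p-supp z nz = inZ-S z (subst (_≤ B) (sym (ind-nz (S z ℕ.≟ m) nz)) m≤B)

  -- if (i - m)² = m then i - m ≤ m
  q-supp : ∀ i → q i ≢ 0 → i ≤ 2 * m
  q-supp i nz with ℕP.≤-total i m
  ... | inj₁ i≤m = ℕP.≤-trans i≤m (ℕP.m≤m+n m (m + 0))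
  ... | inj₂ m≤i = subst (_≤ 2 * m) d+m≡i (ℕP.+-mono-≤ d≤m (ℕP.m≤m+n m 0))
    where
    d = i ∸ m
    d+m≡i : d + m ≡ i
    d+m≡i = ℕP.m∸n+n≡m m≤i
    g≡d : g i ≡ pos d
    g≡d = trans (cong (λ t → pos t ℤ.- pos m) (sym d+m≡i)) (add-sub (pos d) (pos m))
    d≤m : d ≤ m
    d≤m = subst (d ≤_) (ℤP.+-injective (trans (S-square (pos d))
                        (trans (cong (λ t → t ℤ.* t) (sym g≡d)) (ind-nz (g i ℤ.* g i ℤ.≟ pos m) nz))))
                (n≤n*n d)

-- 2ψ counts the triangular weights: T takes each value on x and -1-x.
ψ-count : IsCount T (2 · ψ)
ψ-count m B m≤B = sym (trans (lsum-zl B _) (trans (cong₂ _+_ half half)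
   (cong (λ t → ψ m + t) (sym (ℕP.+-identityʳ (ψ m))))))
  where
  half : lsum (range B) (λ i → ind ⌊ tri i ℕ.≟ m ⌋) ≡ ψ m
  half = trans (cong (λ t → lsum (range t) (λ i → ind ⌊ tri i ℕ.≟ m ⌋)) (sym (ℕP.m+[n∸m]≡n m≤B)))
    (trans (range-extend m (B ∸ m) _
             (λ i m<i → ind-no (tri i ℕ.≟ m) (λ e → ℕP.<-irrefl (sym e) (ℕP.<-≤-trans m<i (n≤tri i)))))
    (trans (lsum-ext (range m) (λ i → ind-iff (tri i ℕ.≟ m) (i * suc i ℕ.≟ 2 * m)
              (λ e → trans (sym (tri-double i)) (cong (2 *_) e))
              (λ e → ℕP.*-cancelˡ-≡ (tri i) m 2 (trans (tri-double i) e))))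
      (sym (sumTo-lsum m _))))

dil-count : ∀ k {e f} → IsCount e f → IsCount (λ z → suc k * e z) (dil (suc k) f)
dil-count k {e} {f} cf m B m≤B =
  trans (sumTo-lsum m _)
  (trans (range-ext m _ _ (λ j j≤m → cong (ind ⌊ suc k * j ℕ.≟ m ⌋ *_) (cf j B (ℕP.≤-trans j≤m m≤B))))
  (trans (lsum-ext (range m) (λ j → sym (lsum-*ˡ (zl B) (ind ⌊ suc k * j ℕ.≟ m ⌋) _)))
  (trans (lsum-swap (range m) (zl B) _)
  (lsum-ext (zl B) collapse))))
  where
  collapse : ∀ z → lsum (range m) (λ j → ind ⌊ suc k * j ℕ.≟ m ⌋ * ind ⌊ e z ℕ.≟ j ⌋) ≡
                   ind ⌊ suc k * e z ℕ.≟ m ⌋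
  collapse z with e z ℕ.≤? m
  ... | yes ez≤m = trans (lsum-ext (range m) (λ j → ℕP.*-comm (ind ⌊ suc k * j ℕ.≟ m ⌋) _))
                         (range-δ-in m (e z) (λ j → ind ⌊ suc k * j ℕ.≟ m ⌋) ez≤m)
  ... | no ez≰m = trans (lsum-ext (range m) (λ j → ℕP.*-comm (ind ⌊ suc k * j ℕ.≟ m ⌋) _))
                   (trans (range-δ-out m (e z) (λ j → ind ⌊ suc k * j ℕ.≟ m ⌋) ez≰m)
                     (sym (ind-no (suc k * e z ℕ.≟ m) (λ eq → ez≰m (subst (e z ≤_) eq (ℕP.m≤m+n (e z) (k * e z)))))))

conv-count : ∀ {e₁ e₂ f g} → IsCount e₁ f → IsCount e₂ g → IsCount2 (λ z w → e₁ z + e₂ w) (f ⊛ g)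
conv-count {e₁} {e₂} {f} {g} cf cg m B m≤B =
  trans (sumTo-lsum m _)
  (trans (range-ext m _ _ (λ k k≤m → cong₂ _*_ (cf k B (ℕP.≤-trans k≤m m≤B))
                                               (cg (m ∸ k) B (ℕP.≤-trans (ℕP.m∸n≤m m k) m≤B))))
  (trans (lsum-ext (range m) (λ k → trans (sym (lsum-*ʳ (zl B) _ _))
             (lsum-ext (zl B) (λ z → sym (lsum-*ˡ (zl B) (ind ⌊ e₁ z ℕ.≟ k ⌋) _)))))
  (trans (lsum-swap (range m) (zl B) _)
  (lsum-ext (zl B) (λ z → trans (lsum-swap (range m) (zl B) _) (lsum-ext (zl B) (collapse z)))))))
  where
  collapse : ∀ z w → lsum (range m) (λ k → ind ⌊ e₁ z ℕ.≟ k ⌋ * ind ⌊ e₂ w ℕ.≟ m ∸ k ⌋) ≡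
                     ind ⌊ e₁ z + e₂ w ℕ.≟ m ⌋
  collapse z w with e₁ z ℕ.≤? m
  ... | yes le = trans (range-δ-in m (e₁ z) (λ k → ind ⌊ e₂ w ℕ.≟ m ∸ k ⌋) le)
                    (ind-iff _ _ (λ e → trans (cong (λ t → e₁ z + t) e) (ℕP.m+[n∸m]≡n le))
                                 (λ e → trans (sym (ℕP.m+n∸m≡n (e₁ z) (e₂ w))) (cong (_∸ e₁ z) e)))
  ... | no nle = trans (range-δ-out m (e₁ z) _ nle)
                   (sym (ind-no (e₁ z + e₂ w ℕ.≟ m) (λ e → nle (subst (e₁ z ≤_) e (ℕP.m≤m+n (e₁ z) (e₂ w))))))

shift-count : ∀ s {E F} → IsCount2 E F → IsCount2 (λ z w → s + E z w) (shift s F)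
shift-count s {E} {F} cF m B m≤B with s ≤ᵇ m | ℕP.≤ᵇ-reflects-≤ s m
... | true | ofʸ s≤m =
  trans (cF (m ∸ s) B (ℕP.≤-trans (ℕP.m∸n≤m m s) m≤B))
  (lsum-ext (zl B) (λ z → lsum-ext (zl B) (λ w → ind-iff _ _
     (λ e → trans (cong (λ t → s + t) e) (ℕP.m+[n∸m]≡n s≤m))
     (λ e → trans (sym (ℕP.m+n∸m≡n s (E z w))) (cong (_∸ s) e)))))
... | false | ofⁿ s≰m =
  sym (lsum-0 (zl B) _ (λ z → lsum-0 (zl B) _ (λ w → ind-no (s + E z w ℕ.≟ m)
     (λ e → s≰m (subst (s ≤_) e (ℕP.m≤m+n s (E z w)))))))

count2-flip : ∀ {E F} → IsCount2 E F → IsCount2 (λ z w → E w z) F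
count2-flip {E} cF m B m≤B = trans (cF m B m≤B) (lsum-swap (zl B) (zl B) (λ z w → ind ⌊ E z w ℕ.≟ m ⌋))

count2-cong : ∀ {E E' F} → (∀ z w → E z w ≡ E' z w) → IsCount2 E F → IsCount2 E' F
count2-cong {E} {E'} E≡E' cF m B m≤B = trans (cF m B m≤B)
  (lsum-ext (zl B) (λ z → lsum-ext (zl B) (λ w → cong (λ t → ind ⌊ t ℕ.≟ m ⌋) (E≡E' z w))))

sumTo-cong : ∀ n {f g : ℕ → ℕ} → (∀ i → f i ≡ g i) → sumTo n f ≡ sumTo n g
sumTo-cong zero h = h 0
sumTo-cong (suc n) h = cong₂ _+_ (sumTo-cong n h) (h (suc n))

sumTo-*ˡ : ∀ n c (f : ℕ → ℕ) → sumTo n (λ i → c * f i) ≡ c * sumTo n f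
sumTo-*ˡ zero c f = refl
sumTo-*ˡ (suc n) c f = trans (cong (_+ c * f (suc n)) (sumTo-*ˡ n c f)) (sym (ℕP.*-distribˡ-+ c _ _))

dil-· : ∀ k c f → dil k (c · f) ≗ c · dil k f
dil-· k c f m = trans (sumTo-cong m (λ j → x∙yz≈y∙xz (ind ⌊ k * j ℕ.≟ m ⌋) c (f j))) (sumTo-*ˡ m c _)

⊛-·ˡ : ∀ c f g → (c · f) ⊛ g ≗ c · (f ⊛ g)
⊛-·ˡ c f g m = trans (sumTo-cong m (λ k → ℕP.*-assoc c (f k) _)) (sumTo-*ˡ m c _)

⊛-·ʳ : ∀ c f g → f ⊛ (c · g) ≗ c · (f ⊛ g)
⊛-·ʳ c f g m = trans (sumTo-cong m (λ k → x∙yz≈y∙xz (f k) c _)) (sumTo-*ˡ m c _)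

⊛-cong : ∀ {f f' g g'} → f ≗ f' → g ≗ g' → f ⊛ g ≗ f' ⊛ g'
⊛-cong f≗f' g≗g' m = sumTo-cong m (λ k → cong₂ _*_ (f≗f' k) (g≗g' (m ∸ k)))

shift-· : ∀ s c f → shift s (c · f) ≗ c · shift s f
shift-· s c f m with s ≤ᵇ m
... | true = refl
... | false = sym (ℕP.*-zeroʳ c)

shift-cong : ∀ s {F G} → F ≗ G → shift s F ≗ shift s G
shift-cong s F≗G m with s ≤ᵇ m
... | true = F≗G (m ∸ s)
... | false = refl

mod-elim : ∀ d .{{_ : NonZero d}} (P : ℤ → Set) → (∀ r k → r < d → P (+ r ℤ.+ k ℤ.* + d)) → ∀ z → P z
mod-elim d P h z = subst P (sym (ℤD.a≡a%ℕn+[a/ℕn]*n z d)) (h (z ℤ.%ℕ d) (z ℤ./ℕ d) (ℤD.n%ℕd<d z d))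

mod-elim₂ : ∀ d .{{_ : NonZero d}} (P : ℤ → ℤ → Set) →
  (∀ r k r' k' → r < d → r' < d → P (+ r ℤ.+ k ℤ.* + d) (+ r' ℤ.+ k' ℤ.* + d)) → ∀ x y → P x y
mod-elim₂ d P h x y =
  mod-elim d (λ x → P x y) (λ r k r<d → mod-elim d (P (+ r ℤ.+ k ℤ.* + d)) (λ r' k' r'<d → h r k r' k' r<d r'<d) y) x

remainder-unique : ∀ d r r' k k' → r < d → r' < d → + r ℤ.+ k ℤ.* + d ≡ + r' ℤ.+ k' ℤ.* + d → r ≡ r'
remainder-unique d r r' k k' r<d r'<d e = core (k ℤ.- k') (trans (add-sub (+ r') (k' ℤ.* + d))
  (trans (cong (ℤ._- k' ℤ.* + d) (sym e)) (difference (+ r) k k' (+ d))))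
  where
  add-sub : ∀ x y → x ≡ x ℤ.+ y ℤ.- y
  add-sub = solve-∀
  difference : ∀ x k k' d → x ℤ.+ k ℤ.* d ℤ.- k' ℤ.* d ≡ x ℤ.+ (k ℤ.- k') ℤ.* d
  difference = solve-∀
  sub-add : ∀ a c w → a ≡ (a ℤ.+ (ℤ.- c) ℤ.* w) ℤ.+ c ℤ.* w
  sub-add = solve-∀
  -- two remainders differing by a non-zero multiple of d cannot both be below d
  big : ∀ x y t → x ≡ y + suc t * d → d ≤ x
  big x y t e = subst (d ≤_) (sym e) (ℕP.≤-trans (ℕP.m≤m+n d (t * d)) (ℕP.m≤n+m (suc t * d) y))
  core : ∀ j → + r' ≡ + r ℤ.+ j ℤ.* + d → r ≡ r'
  core (+ zero) e = sym (trans (ℤP.+-injective e) (ℕP.+-identityʳ r))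
  core (+ suc t) e = ⊥-elim (ℕP.<-irrefl refl (ℕP.<-≤-trans r'<d (big r' r t
    (ℤP.+-injective (trans e (cong (λ u → + r ℤ.+ u) (sym (ℤP.pos-* (suc t) d))))))))
  core -[1+ t ] e = ⊥-elim (ℕP.<-irrefl refl (ℕP.<-≤-trans r<d (big r r' t
    (ℤP.+-injective (trans (sub-add (+ r) (+ suc t) (+ d))
      (trans (cong (ℤ._+ + suc t ℤ.* + d) (sym e)) (cong (λ u → + r' ℤ.+ u) (sym (ℤP.pos-* (suc t) d)))))))))

remainder-canonical : ∀ d .{{_ : NonZero d}} r k → r < d → (+ r ℤ.+ k ℤ.* + d) ℤ.%ℕ d ≡ r
remainder-canonical d r k r<d =
  remainder-unique d (z ℤ.%ℕ d) r (z ℤ./ℕ d) k (ℤD.n%ℕd<d z d) r<d (sym (ℤD.a≡a%ℕn+[a/ℕn]*n z d))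
  where z = + r ℤ.+ k ℤ.* + d

isRes : (d : ℕ) .{{_ : NonZero d}} → ℕ → ℤ → ℕ
isRes d r z = ind ⌊ z ℤ.%ℕ d ℕ.≟ r ⌋

isRes-at : ∀ d .{{_ : NonZero d}} r s k {z} → s < d → z ≡ + s ℤ.+ k ℤ.* + d → isRes d r z ≡ ind ⌊ s ℕ.≟ r ⌋
isRes-at d r s k s<d refl = cong (λ t → ind ⌊ t ℕ.≟ r ⌋) (remainder-canonical d s k s<d)

isRes-onto : ∀ d .{{_ : NonZero d}} r z → isRes d r z ≢ 0 → Σ ℤ λ x → + r ℤ.+ x ℤ.* + d ≡ z
isRes-onto d r z nz = z ℤ./ℕ d ,
  sym (trans (ℤD.a≡a%ℕn+[a/ℕn]*n z d) (cong (λ t → + t ℤ.+ z ℤ./ℕ d ℤ.* + d) (ind-nz (z ℤ.%ℕ d ℕ.≟ r) nz)))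

progression-inj : ∀ d .{{_ : NonZero d}} r x y → + r ℤ.+ x ℤ.* + d ≡ + r ℤ.+ y ℤ.* + d → x ≡ y
progression-inj d r x y e = ℤP.*-cancelʳ-≡ x y (+ d) (ℤ+-cancelˡ (+ r) _ _ e)

c0 c2 od : ℤ → ℕ
c0 = isRes 4 0
c2 = isRes 4 2
od = isRes 2 1

0<2 : 0 < 2
0<2 = s≤s z≤n
1<2 : 1 < 2
1<2 = s≤s (s≤s z≤n)
0<4 : 0 < 4
0<4 = s≤s z≤n
2<4 : 2 < 4
2<4 = s≤s (s≤s (s≤s z≤n))

partition : ∀ a → c0 a + c2 a + od a ≡ 1
partition = mod-elim 4 (λ a → c0 a + c2 a + od a ≡ 1) by-residue
  where
  residues : ∀ {z} s k → s < 4 → z ≡ + s ℤ.+ k ℤ.* + 4 → ∀ t j → t < 2 → z ≡ + t ℤ.+ j ℤ.* + 2 →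
    c0 z + c2 z + od z ≡ ind ⌊ s ℕ.≟ 0 ⌋ + ind ⌊ s ℕ.≟ 2 ⌋ + ind ⌊ t ℕ.≟ 1 ⌋
  residues s k s<4 e t j t<2 e' = cong₂ _+_ (cong₂ _+_ (isRes-at 4 0 s k s<4 e) (isRes-at 4 2 s k s<4 e)) (isRes-at 2 1 t j t<2 e')
  halve₀ : ∀ k → + 0 ℤ.+ k ℤ.* + 4 ≡ + 0 ℤ.+ (k ℤ.* + 2) ℤ.* + 2
  halve₀ = solve-∀
  halve₁ : ∀ k → + 1 ℤ.+ k ℤ.* + 4 ≡ + 1 ℤ.+ (k ℤ.* + 2) ℤ.* + 2
  halve₁ = solve-∀
  halve₂ : ∀ k → + 2 ℤ.+ k ℤ.* + 4 ≡ + 0 ℤ.+ (k ℤ.* + 2 ℤ.+ + 1) ℤ.* + 2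
  halve₂ = solve-∀
  halve₃ : ∀ k → + 3 ℤ.+ k ℤ.* + 4 ≡ + 1 ℤ.+ (k ℤ.* + 2 ℤ.+ + 1) ℤ.* + 2
  halve₃ = solve-∀
  by-residue : ∀ r k → r < 4 → c0 (+ r ℤ.+ k ℤ.* + 4) + c2 (+ r ℤ.+ k ℤ.* + 4) + od (+ r ℤ.+ k ℤ.* + 4) ≡ 1
  by-residue 0 k r<4 = residues 0 k r<4 refl 0 (k ℤ.* + 2) 0<2 (halve₀ k)
  by-residue 1 k r<4 = residues 1 k r<4 refl 1 (k ℤ.* + 2) 1<2 (halve₁ k)
  by-residue 2 k r<4 = residues 2 k r<4 refl 0 (k ℤ.* + 2 ℤ.+ + 1) 0<2 (halve₂ k)
  by-residue 3 k r<4 = residues 3 k r<4 refl 1 (k ℤ.* + 2 ℤ.+ + 1) 1<2 (halve₃ k)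
  by-residue (suc (suc (suc (suc r)))) k (s≤s (s≤s (s≤s (s≤s ()))))

record Class : Set where
  field
    modulus residue scale offset : ℕ
    ⦃ modulus-nz ⦄ : NonZero modulus
    ⦃ scale-nz ⦄ : NonZero scale
    residue<modulus : residue < modulus
    weight : ℤ → ℕ
    weight-box : ∀ {B} x → weight x ≤ B → InZ B x

  member : ℤ → ℕ
  member = isRes modulus residue

  point : ℤ → ℤ
  point x = + residue ℤ.+ x ℤ.* + modulus

  field
    square : ∀ x → S (point x) ≡ scale * weight x + offset
open Class

square-via : ∀ p a w c → p ℤ.* p ≡ + a ℤ.* + w ℤ.+ + c → S p ≡ a * w + c
square-via p a w c e = ℤP.+-injective (trans (S-square p) (trans e (cong (ℤ._+ + c) (sym (ℤP.pos-* a w)))))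

class0 : Class
class0 = record
  { modulus = 4 ; residue = 0 ; scale = 16 ; offset = 0 ; residue<modulus = 0<4
  ; weight = S ; weight-box = inZ-S
  ; square = λ x → square-via (+ 0 ℤ.+ x ℤ.* + 4) 16 (S x) 0
                     (trans (expand x) (cong (λ t → + 16 ℤ.* t ℤ.+ + 0) (sym (S-square x)))) }
  where
  expand : ∀ x → (+ 0 ℤ.+ x ℤ.* + 4) ℤ.* (+ 0 ℤ.+ x ℤ.* + 4) ≡ + 16 ℤ.* (x ℤ.* x) ℤ.+ + 0
  expand = solve-∀

-- (4x + 2)² = 16x(x+1) + 4 = 32·T x + 4
class2 : Class
class2 = record
  { modulus = 4 ; residue = 2 ; scale = 32 ; offset = 4 ; residue<modulus = 2<4
  ; weight = T ; weight-box = inZ-T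
  ; square = λ x → square-via (+ 2 ℤ.+ x ℤ.* + 4) 32 (T x) 4
                     (trans (expand x) (trans (cong (λ t → + 16 ℤ.* t ℤ.+ + 4) (sym (T-double x))) (collect (+ T x)))) }
  where
  expand : ∀ x → (+ 2 ℤ.+ x ℤ.* + 4) ℤ.* (+ 2 ℤ.+ x ℤ.* + 4) ≡ + 16 ℤ.* (x ℤ.* (x ℤ.+ + 1)) ℤ.+ + 4
  expand = solve-∀
  collect : ∀ t → + 16 ℤ.* (+ 2 ℤ.* t) ℤ.+ + 4 ≡ + 32 ℤ.* t ℤ.+ + 4
  collect = solve-∀

-- (2x + 1)² = 4x(x+1) + 1 = 8·T x + 1
classOdd : Class
classOdd = record
  { modulus = 2 ; residue = 1 ; scale = 8 ; offset = 1 ; residue<modulus = 1<2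
  ; weight = T ; weight-box = inZ-T
  ; square = λ x → square-via (+ 1 ℤ.+ x ℤ.* + 2) 8 (T x) 1
                     (trans (expand x) (trans (cong (λ t → + 4 ℤ.* t ℤ.+ + 1) (sym (T-double x))) (collect (+ T x)))) }
  where
  expand : ∀ x → (+ 1 ℤ.+ x ℤ.* + 2) ℤ.* (+ 1 ℤ.+ x ℤ.* + 2) ≡ + 4 ℤ.* (x ℤ.* (x ℤ.+ + 1)) ℤ.+ + 1
  expand = solve-∀
  collect : ∀ t → + 4 ℤ.* (+ 2 ℤ.* t) ℤ.+ + 1 ≡ + 8 ℤ.* t ℤ.+ + 1
  collect = solve-∀

energy : Class → Class → ℤ → ℤ → ℕ
energy X Y x y = (offset X + 3 * offset Y) + (scale X * weight X x + 3 * scale Y * weight Y y)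

energy-form : ∀ X Y x y → 1 * S (point X x) + 3 * S (point Y y) ≡ energy X Y x y
energy-form X Y x y = trans (cong₂ (λ u v → 1 * u + 3 * v) (square X x) (square Y y))
  (regroup (scale X) (weight X x) (offset X) (scale Y) (weight Y y) (offset Y))
  where
  regroup : ∀ a w c a' w' c' → 1 * (a * w + c) + 3 * (a' * w' + c') ≡ (c + 3 * c') + (a * w + 3 * a' * w')
  regroup = ℕ-Ring.solve-∀

summands-≤ : ∀ c u v {m} → c + (u + v) ≡ m → u ≤ m × v ≤ m
summands-≤ c u v refl = ℕP.≤-trans (ℕP.m≤m+n u v) (ℕP.m≤n+m (u + v) c)
                      , ℕP.≤-trans (ℕP.m≤n+m v u) (ℕP.m≤n+m (u + v) c)

-- Sums over the square box [-(n+1) , n]², which contains every (a , b) with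
-- a² + 3b² = n, and the class-restricted representation counts.
module Representations (n : ℕ) where

  box : Enumeration (ℤ × ℤ)
  box = pairE (zE n) (zE n)

  Σ□ : (ℤ × ℤ → ℕ) → ℕ
  Σ□ = lsum (elems box)

  Σ□-ext : ∀ f g → (∀ a b → f (a , b) ≡ g (a , b)) → Σ□ f ≡ Σ□ g
  Σ□-ext f g h = lsum-ext (elems box) (λ { (a , b) → h a b })

  Σ□-+ : ∀ f g → Σ□ (λ i → f i + g i) ≡ Σ□ f + Σ□ g
  Σ□-+ = lsum-+ (elems box)

  Σ□-+3 : ∀ f g h → Σ□ (λ i → f i + g i + h i) ≡ Σ□ f + Σ□ g + Σ□ h
  Σ□-+3 f g h = trans (Σ□-+ (λ i → f i + g i) h) (cong (_+ Σ□ h) (Σ□-+ f g))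

  solutions : (ℤ → ℤ → ℕ) → ℤ × ℤ → ℕ
  solutions E (x , y) = ind ⌊ E x y ℕ.≟ n ⌋

  coefficient : ∀ {E F} → IsCount2 E F → F n ≡ Σ□ (solutions E)
  coefficient {E} cF = trans (cF n n ℕP.≤-refl) (sym (lsum-pairs (zl n) (zl n) (solutions E)))

  rep : ℤ → ℤ → ℕ
  rep a b = ind ⌊ 1 * S a + 3 * S b ℕ.≟ n ⌋

  rep-bound : ∀ a b → rep a b ≢ 0 → S a ≤ n × S b ≤ n
  rep-bound a b nz =
    let (le , le') = summands-≤ 0 (1 * S a) (3 * S b) (ind-nz (1 * S a + 3 * S b ℕ.≟ n) nz)
    in ℕP.≤-trans (ℕP.m≤n*m (S a) 1) le , ℕP.≤-trans (ℕP.m≤n*m (S b) 3) le'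

  rep-box : ∀ a b → rep a b ≢ 0 → In box (a , b)
  rep-box a b nz = let (le , le') = rep-bound a b nz in inZ-S a le , inZ-S b le'

  restrict : (ℤ → ℕ) → (ℤ → ℕ) → ℤ × ℤ → ℕ
  restrict cx cy (a , b) = cx a * cy b * rep a b

  class-sum : ∀ X Y → Σ□ (restrict (member X) (member Y)) ≡ Σ□ (solutions (energy X Y))
  class-sum X Y = sum-reindex box box (restrict (member X) (member Y)) (solutions (energy X Y)) g
    on-image g-inj g-onto in-box solution-box
    where
    g : ℤ × ℤ → ℤ × ℤ
    g (x , y) = point X x , point Y y

    on-image : ∀ j → solutions (energy X Y) j ≡ restrict (member X) (member Y) (g j)
    on-image (x , y) = sym (begin
      member X (point X x) * member Y (point Y y) * rep (point X x) (point Y y)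
        ≡⟨ cong₂ (λ u v → u * v * rep (point X x) (point Y y))
                 (isRes-at (modulus X) (residue X) (residue X) x (residue<modulus X) refl)
                 (isRes-at (modulus Y) (residue Y) (residue Y) y (residue<modulus Y) refl) ⟩
      ind ⌊ residue X ℕ.≟ residue X ⌋ * ind ⌊ residue Y ℕ.≟ residue Y ⌋ * rep (point X x) (point Y y)
        ≡⟨ cong₂ (λ u v → u * v * rep (point X x) (point Y y)) (ind-yes (residue X ℕ.≟ residue X) refl)
                                                               (ind-yes (residue Y ℕ.≟ residue Y) refl) ⟩
      1 * 1 * rep (point X x) (point Y y)
        ≡⟨ ℕP.+-identityʳ _ ⟩
      rep (point X x) (point Y y)
        ≡⟨ cong (λ t → ind ⌊ t ℕ.≟ n ⌋) (energy-form X Y x y) ⟩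
      solutions (energy X Y) (x , y) ∎)
      where open ≡-Reasoning

    g-inj : ∀ j j' → g j ≡ g j' → j ≡ j'
    g-inj (x , y) (x' , y') e = cong₂ _,_ (progression-inj (modulus X) (residue X) x x' (cong proj₁ e))
                                          (progression-inj (modulus Y) (residue Y) y y' (cong proj₂ e))

    g-onto : ∀ i → restrict (member X) (member Y) i ≢ 0 → Σ (ℤ × ℤ) λ j → g j ≡ i
    g-onto (a , b) nz =
      let nz-ab = nz*ˡ (member X a * member Y b) (rep a b) nz
          (x , ex) = isRes-onto (modulus X) (residue X) a (nz*ˡ (member X a) (member Y b) nz-ab)
          (y , ey) = isRes-onto (modulus Y) (residue Y) b (nz*ʳ (member X a) (member Y b) nz-ab)
      in (x , y) , cong₂ _,_ ex ey

    in-box : ∀ i → restrict (member X) (member Y) i ≢ 0 → In box i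
    in-box (a , b) nz = rep-box a b (nz*ʳ (member X a * member Y b) (rep a b) nz)

    -- each weight is at most the energy
    solution-box : ∀ j → solutions (energy X Y) j ≢ 0 → In box j
    solution-box (x , y) nz =
      let (le , le') = summands-≤ (offset X + 3 * offset Y) (scale X * weight X x) (3 * scale Y * weight Y y)
                                  (ind-nz (energy X Y x y ℕ.≟ n) nz)
      in weight-box X x (ℕP.≤-trans (ℕP.m≤n*m (weight X x) (scale X)) le)
       , weight-box Y y (ℕP.≤-trans (ℕP.m≤n*m (weight Y y) (3 * scale Y) ⦃ ℕP.m*n≢0 3 (scale Y) ⦄) le')

ev : ℤ → ℕ
ev = isRes 2 0

isRes-shift : ∀ d .⦃ _ : NonZero d ⦄ r z k → isRes d r (z ℤ.+ k ℤ.* + d) ≡ isRes d r z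
isRes-shift d r z k = mod-elim d (λ z → isRes d r (z ℤ.+ k ℤ.* + d) ≡ isRes d r z)
  (λ s j s<d → trans (isRes-at d r s (j ℤ.+ k) s<d (regroup (+ s) j k (+ d))) (sym (isRes-at d r s j s<d refl))) z
  where
  regroup : ∀ s j k d → s ℤ.+ j ℤ.* d ℤ.+ k ℤ.* d ≡ s ℤ.+ (j ℤ.+ k) ℤ.* d
  regroup = solve-∀

parity-at : ∀ r s k → s < 2 → isRes 2 r (+ s ℤ.+ k ℤ.* + 2) ≡ ind ⌊ s ℕ.≟ r ⌋
parity-at r s k s<2 = isRes-at 2 r s k s<2 refl

double-classes : ∀ σ → (c0 (+ 2 ℤ.* σ) ≡ ev σ) × (c2 (+ 2 ℤ.* σ) ≡ od σ)
double-classes = mod-elim 2 (λ σ → (c0 (+ 2 ℤ.* σ) ≡ ev σ) × (c2 (+ 2 ℤ.* σ) ≡ od σ)) by-parity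
  where
  double₀ : ∀ k → + 2 ℤ.* (+ 0 ℤ.+ k ℤ.* + 2) ≡ + 0 ℤ.+ k ℤ.* + 4
  double₀ = solve-∀
  double₁ : ∀ k → + 2 ℤ.* (+ 1 ℤ.+ k ℤ.* + 2) ≡ + 2 ℤ.+ k ℤ.* + 4
  double₁ = solve-∀
  by-parity : ∀ s k → s < 2 → (c0 (+ 2 ℤ.* (+ s ℤ.+ k ℤ.* + 2)) ≡ ev (+ s ℤ.+ k ℤ.* + 2))
                             × (c2 (+ 2 ℤ.* (+ s ℤ.+ k ℤ.* + 2)) ≡ od (+ s ℤ.+ k ℤ.* + 2))
  by-parity 0 k s<2 = trans (isRes-at 4 0 0 k 0<4 (double₀ k)) (sym (parity-at 0 0 k s<2))
                    , trans (isRes-at 4 2 0 k 0<4 (double₀ k)) (sym (parity-at 1 0 k s<2))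
  by-parity 1 k s<2 = trans (isRes-at 4 0 2 k 2<4 (double₁ k)) (sym (parity-at 0 1 k s<2))
                    , trans (isRes-at 4 2 2 k 2<4 (double₁ k)) (sym (parity-at 1 1 k s<2))
  by-parity (suc (suc s)) k (s≤s (s≤s ()))

od-difference : ∀ σ τ → od (σ ℤ.- τ) ≡ ev σ * od τ + od σ * ev τ
od-difference = mod-elim₂ 2 (λ σ τ → od (σ ℤ.- τ) ≡ ev σ * od τ + od σ * ev τ)
  (λ s k s' k' s<2 s'<2 → trans (by-parities s k s' k' s<2 s'<2) (sym (parities s k s' k' s<2 s'<2)))
  where
  parities : ∀ s k s' k' → s < 2 → s' < 2 →
    ev (+ s ℤ.+ k ℤ.* + 2) * od (+ s' ℤ.+ k' ℤ.* + 2) + od (+ s ℤ.+ k ℤ.* + 2) * ev (+ s' ℤ.+ k' ℤ.* + 2)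
      ≡ ind ⌊ s ℕ.≟ 0 ⌋ * ind ⌊ s' ℕ.≟ 1 ⌋ + ind ⌊ s ℕ.≟ 1 ⌋ * ind ⌊ s' ℕ.≟ 0 ⌋
  parities s k s' k' s<2 s'<2 = cong₂ _+_ (cong₂ _*_ (parity-at 0 s k s<2) (parity-at 1 s' k' s'<2))
                                          (cong₂ _*_ (parity-at 1 s k s<2) (parity-at 0 s' k' s'<2))
  diff₀₀ : ∀ k k' → (+ 0 ℤ.+ k ℤ.* + 2) ℤ.- (+ 0 ℤ.+ k' ℤ.* + 2) ≡ + 0 ℤ.+ (k ℤ.- k') ℤ.* + 2
  diff₀₀ = solve-∀
  diff₀₁ : ∀ k k' → (+ 0 ℤ.+ k ℤ.* + 2) ℤ.- (+ 1 ℤ.+ k' ℤ.* + 2) ≡ + 1 ℤ.+ (k ℤ.- k' ℤ.- + 1) ℤ.* + 2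
  diff₀₁ = solve-∀
  diff₁₀ : ∀ k k' → (+ 1 ℤ.+ k ℤ.* + 2) ℤ.- (+ 0 ℤ.+ k' ℤ.* + 2) ≡ + 1 ℤ.+ (k ℤ.- k') ℤ.* + 2
  diff₁₀ = solve-∀
  diff₁₁ : ∀ k k' → (+ 1 ℤ.+ k ℤ.* + 2) ℤ.- (+ 1 ℤ.+ k' ℤ.* + 2) ≡ + 0 ℤ.+ (k ℤ.- k') ℤ.* + 2
  diff₁₁ = solve-∀
  by-parities : ∀ s k s' k' → s < 2 → s' < 2 → od ((+ s ℤ.+ k ℤ.* + 2) ℤ.- (+ s' ℤ.+ k' ℤ.* + 2))
      ≡ ind ⌊ s ℕ.≟ 0 ⌋ * ind ⌊ s' ℕ.≟ 1 ⌋ + ind ⌊ s ℕ.≟ 1 ⌋ * ind ⌊ s' ℕ.≟ 0 ⌋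
  by-parities 0 k 0 k' _ _ = isRes-at 2 1 0 (k ℤ.- k') 0<2 (diff₀₀ k k')
  by-parities 0 k 1 k' _ _ = isRes-at 2 1 1 (k ℤ.- k' ℤ.- + 1) 1<2 (diff₀₁ k k')
  by-parities 1 k 0 k' _ _ = isRes-at 2 1 1 (k ℤ.- k') 1<2 (diff₁₀ k k')
  by-parities 1 k 1 k' _ _ = isRes-at 2 1 0 (k ℤ.- k') 0<2 (diff₁₁ k k')
  by-parities (suc (suc s)) k s' k' (s≤s (s≤s ())) _
  by-parities s k (suc (suc s')) k' _ (s≤s (s≤s ()))

od-neg : ∀ z → od (ℤ.- z) ≡ od z
od-neg = mod-elim 2 (λ z → od (ℤ.- z) ≡ od z) by-parity
  where
  neg₀ : ∀ k → ℤ.- (+ 0 ℤ.+ k ℤ.* + 2) ≡ + 0 ℤ.+ (ℤ.- k) ℤ.* + 2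
  neg₀ = solve-∀
  neg₁ : ∀ k → ℤ.- (+ 1 ℤ.+ k ℤ.* + 2) ≡ + 1 ℤ.+ (ℤ.- k ℤ.- + 1) ℤ.* + 2
  neg₁ = solve-∀
  by-parity : ∀ s k → s < 2 → od (ℤ.- (+ s ℤ.+ k ℤ.* + 2)) ≡ od (+ s ℤ.+ k ℤ.* + 2)
  by-parity 0 k s<2 = trans (isRes-at 2 1 0 (ℤ.- k) 0<2 (neg₀ k)) (sym (parity-at 1 0 k s<2))
  by-parity 1 k s<2 = trans (isRes-at 2 1 1 (ℤ.- k ℤ.- + 1) 1<2 (neg₁ k)) (sym (parity-at 1 1 k s<2))
  by-parity (suc (suc s)) k (s≤s (s≤s ()))

ev-succ : ∀ a → ev a + ev (a ℤ.+ + 1) ≡ 1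
ev-succ = mod-elim 2 (λ a → ev a + ev (a ℤ.+ + 1) ≡ 1) by-parity
  where
  succ₀ : ∀ k → + 0 ℤ.+ k ℤ.* + 2 ℤ.+ + 1 ≡ + 1 ℤ.+ k ℤ.* + 2
  succ₀ = solve-∀
  succ₁ : ∀ k → + 1 ℤ.+ k ℤ.* + 2 ℤ.+ + 1 ≡ + 0 ℤ.+ (k ℤ.+ + 1) ℤ.* + 2
  succ₁ = solve-∀
  by-parity : ∀ s k → s < 2 → ev (+ s ℤ.+ k ℤ.* + 2) + ev (+ s ℤ.+ k ℤ.* + 2 ℤ.+ + 1) ≡ 1
  by-parity 0 k s<2 = cong₂ _+_ (parity-at 0 0 k s<2) (isRes-at 2 0 1 k 1<2 (succ₀ k))
  by-parity 1 k s<2 = cong₂ _+_ (parity-at 0 1 k s<2) (isRes-at 2 0 0 (k ℤ.+ + 1) 0<2 (succ₁ k))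
  by-parity (suc (suc s)) k (s≤s (s≤s ()))

od-idem : ∀ z → od z * od z ≡ od z
od-idem z with z ℤ.%ℕ 2 ℕ.≟ 1
... | yes _ = refl
... | no _ = refl

odd-diagonals : ∀ u v → od u * od v * (c0 (u ℤ.- v) + c0 (u ℤ.+ v)) ≡ od u * od v
odd-diagonals u v with od u ℕ.≟ 0 | od v ℕ.≟ 0
... | yes u-even | _ rewrite u-even = refl
... | no _ | yes v-even rewrite v-even | ℕP.*-zeroʳ (od u) = refl
... | no u-odd | no v-odd =
  let (h , eh) = isRes-onto 2 1 u u-odd
      (h' , eh') = isRes-onto 2 1 v v-odd
  in trans (cong (od u * od v *_) (subst₂ (λ a b → c0 (a ℤ.- b) + c0 (a ℤ.+ b) ≡ 1) eh eh' (sum-diff h h')))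
           (ℕP.*-identityʳ (od u * od v))
  where
  diff : ∀ h h' → (+ 1 ℤ.+ h ℤ.* + 2) ℤ.- (+ 1 ℤ.+ h' ℤ.* + 2) ≡ + 2 ℤ.* (h ℤ.- h')
  diff = solve-∀
  sum : ∀ h h' → (+ 1 ℤ.+ h ℤ.* + 2) ℤ.+ (+ 1 ℤ.+ h' ℤ.* + 2) ≡ + 2 ℤ.* ((h ℤ.- h' ℤ.+ + 1) ℤ.+ h' ℤ.* + 2)
  sum = solve-∀
  sum-diff : ∀ h h' →
    c0 ((+ 1 ℤ.+ h ℤ.* + 2) ℤ.- (+ 1 ℤ.+ h' ℤ.* + 2)) + c0 ((+ 1 ℤ.+ h ℤ.* + 2) ℤ.+ (+ 1 ℤ.+ h' ℤ.* + 2)) ≡ 1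
  sum-diff h h' = trans (cong₂ _+_
      (trans (cong c0 (diff h h')) (proj₁ (double-classes (h ℤ.- h'))))
      (trans (cong c0 (sum h h')) (trans (proj₁ (double-classes (h ℤ.- h' ℤ.+ + 1 ℤ.+ h' ℤ.* + 2)))
                                         (isRes-shift 2 0 (h ℤ.- h' ℤ.+ + 1) h'))))
    (ev-succ (h ℤ.- h'))

S-double : ∀ x → S (+ 2 ℤ.* x) ≡ 4 * S x + 0
S-double x = square-via (+ 2 ℤ.* x) 4 (S x) 0 (trans (expand x) (cong (λ t → + 4 ℤ.* t ℤ.+ + 0) (sym (S-square x))))
  where
  expand : ∀ x → (+ 2 ℤ.* x) ℤ.* (+ 2 ℤ.* x) ≡ + 4 ℤ.* (x ℤ.* x) ℤ.+ + 0
  expand = solve-∀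

module Exchange (n : ℕ) where
  open Representations n

  double : ℤ → ℤ
  double σ = + 2 ℤ.* σ

  mixed : ℤ × ℤ → ℕ
  mixed (s , t) = (c0 s * c2 t + c2 s * c0 t) * rep s t

  halved : ℤ × ℤ → ℕ
  halved (σ , τ) = mixed (double σ , double τ)

  rotate₊ rotate₋ : ℤ × ℤ → ℤ × ℤ
  rotate₊ (σ , τ) = σ ℤ.+ + 3 ℤ.* τ , σ ℤ.- τ
  rotate₋ (σ , τ) = σ ℤ.+ + 3 ℤ.* τ , τ ℤ.- σ

  diagonal₊ diagonal₋ : ℤ × ℤ → ℕ
  diagonal₊ (u , v) = od u * od v * c0 (u ℤ.- v) * rep u v
  diagonal₋ (u , v) = od u * od v * c0 (u ℤ.+ v) * rep u v

  mixed-split : Σ□ mixed ≡ Σ□ (restrict c0 c2) + Σ□ (restrict c2 c0)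
  mixed-split = trans (Σ□-ext mixed _ (λ a b → ℕP.*-distribʳ-+ (rep a b) (c0 a * c2 b) (c2 a * c0 b)))
                      (Σ□-+ (restrict c0 c2) (restrict c2 c0))

  even-onto : ∀ s → c0 s + c2 s ≢ 0 → Σ ℤ λ σ → double σ ≡ s
  even-onto s nz with c0 s ℕ.≟ 0
  ... | no in-class0 = let (x , ex) = isRes-onto 4 0 s in-class0 in x ℤ.* + 2 , trans (double₀ x) ex
    where double₀ : ∀ x → + 2 ℤ.* (x ℤ.* + 2) ≡ + 0 ℤ.+ x ℤ.* + 4
          double₀ = solve-∀
  ... | yes not-class0 = let (x , ex) = isRes-onto 4 2 s (λ e → nz (cong₂ _+_ not-class0 e)) in
                   + 1 ℤ.+ x ℤ.* + 2 , trans (double₁ x) ex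
    where double₁ : ∀ x → + 2 ℤ.* (+ 1 ℤ.+ x ℤ.* + 2) ≡ + 2 ℤ.+ x ℤ.* + 4
          double₁ = solve-∀

  halved-box : ∀ j → halved j ≢ 0 → In box j
  halved-box (σ , τ) nz =
    let (le , le') = rep-bound (double σ) (double τ) (nz*ʳ (c0 (double σ) * c2 (double τ) + c2 (double σ) * c0 (double τ)) _ nz)
    in inZ-S σ (ℕP.≤-trans (ℕP.m≤n*m (S σ) 4) (subst (_≤ n) (trans (S-double σ) (ℕP.+-identityʳ _)) le))
     , inZ-S τ (ℕP.≤-trans (ℕP.m≤n*m (S τ) 4) (subst (_≤ n) (trans (S-double τ) (ℕP.+-identityʳ _)) le'))

  mixed-halve : Σ□ mixed ≡ Σ□ halved
  mixed-halve = sum-reindex box box mixed halved (λ { (σ , τ) → double σ , double τ }) (λ _ → refl)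
    (λ { (σ , τ) (σ' , τ') e → cong₂ _,_ (ℤP.*-cancelˡ-≡ (+ 2) σ σ' (cong proj₁ e))
                                          (ℤP.*-cancelˡ-≡ (+ 2) τ τ' (cong proj₂ e)) })
    onto
    (λ { (s , t) nz → rep-box s t (nz*ʳ (c0 s * c2 t + c2 s * c0 t) (rep s t) nz) })
    halved-box
    where
    onto : ∀ i → mixed i ≢ 0 → Σ (ℤ × ℤ) λ j → (double (proj₁ j) , double (proj₂ j)) ≡ i
    onto (s , t) nz =
      let (s-even , t-even) = nz-cross (c0 s) (c2 t) (c2 s) (c0 t) (nz*ˡ _ (rep s t) nz)
          (σ , eσ) = even-onto s s-even
          (τ , eτ) = even-onto t (λ e → t-even (trans (ℕP.+-comm (c2 t) (c0 t)) e))
      in (σ , τ) , cong₂ _,_ eσ eτ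

  halved-parity : ∀ σ τ → halved (σ , τ) ≡ od (σ ℤ.- τ) * rep (double σ) (double τ)
  halved-parity σ τ = cong (_* rep (double σ) (double τ)) (begin
    c0 (double σ) * c2 (double τ) + c2 (double σ) * c0 (double τ)
      ≡⟨ cong₂ _+_ (cong₂ _*_ (proj₁ (double-classes σ)) (proj₂ (double-classes τ)))
                   (cong₂ _*_ (proj₂ (double-classes σ)) (proj₁ (double-classes τ))) ⟩
    ev σ * od τ + od σ * ev τ
      ≡⟨ od-difference σ τ ⟨
    od (σ ℤ.- τ) ∎)
    where open ≡-Reasoning

  rep-invariant : ∀ a b a' b' →
    a ℤ.* a ℤ.+ + 3 ℤ.* (b ℤ.* b) ≡ a' ℤ.* a' ℤ.+ + 3 ℤ.* (b' ℤ.* b') → rep a b ≡ rep a' b'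
  rep-invariant a b a' b' e =
    cong (λ t → ind ⌊ t ℕ.≟ n ⌋) (ℤP.+-injective (trans (as-integer a b) (trans e (sym (as-integer a' b')))))
    where
    as-integer : ∀ a b → + (1 * S a + 3 * S b) ≡ a ℤ.* a ℤ.+ + 3 ℤ.* (b ℤ.* b)
    as-integer a b = cong₂ ℤ._+_ (trans (cong pos (ℕP.*-identityˡ (S a))) (S-square a))
                                 (trans (ℤP.pos-* 3 (S b)) (cong (+ 3 ℤ.*_) (S-square b)))

  rep-rotate₊ : ∀ σ τ → rep (double σ) (double τ) ≡ rep (σ ℤ.+ + 3 ℤ.* τ) (σ ℤ.- τ)
  rep-rotate₊ σ τ = rep-invariant (double σ) (double τ) (σ ℤ.+ + 3 ℤ.* τ) (σ ℤ.- τ) (form σ τ)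
    where
    form : ∀ σ τ → (+ 2 ℤ.* σ) ℤ.* (+ 2 ℤ.* σ) ℤ.+ + 3 ℤ.* ((+ 2 ℤ.* τ) ℤ.* (+ 2 ℤ.* τ)) ≡
      (σ ℤ.+ + 3 ℤ.* τ) ℤ.* (σ ℤ.+ + 3 ℤ.* τ) ℤ.+ + 3 ℤ.* ((σ ℤ.- τ) ℤ.* (σ ℤ.- τ))
    form = solve-∀

  rep-rotate₋ : ∀ σ τ → rep (double σ) (double τ) ≡ rep (σ ℤ.+ + 3 ℤ.* τ) (τ ℤ.- σ)
  rep-rotate₋ σ τ = rep-invariant (double σ) (double τ) (σ ℤ.+ + 3 ℤ.* τ) (τ ℤ.- σ) (form σ τ)
    where
    form : ∀ σ τ → (+ 2 ℤ.* σ) ℤ.* (+ 2 ℤ.* σ) ℤ.+ + 3 ℤ.* ((+ 2 ℤ.* τ) ℤ.* (+ 2 ℤ.* τ)) ≡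
      (σ ℤ.+ + 3 ℤ.* τ) ℤ.* (σ ℤ.+ + 3 ℤ.* τ) ℤ.+ + 3 ℤ.* ((τ ℤ.- σ) ℤ.* (τ ℤ.- σ))
    form = solve-∀

  diagonal-value : ∀ u v w → od u ≡ od v → c0 w ≡ 1 → od u * od v * c0 w * rep u v ≡ od v * rep u v
  diagonal-value u v w same-parity w≡0 = cong (_* rep u v)
    (trans (cong₂ (λ a b → a * od v * b) same-parity w≡0) (trans (ℕP.*-identityʳ _) (od-idem v)))

  halved-rotate₊ : ∀ j → halved j ≡ diagonal₊ (rotate₊ j)
  halved-rotate₊ (σ , τ) = trans (halved-parity σ τ) (trans (cong (od (σ ℤ.- τ) *_) (rep-rotate₊ σ τ))
    (sym (diagonal-value (σ ℤ.+ + 3 ℤ.* τ) (σ ℤ.- τ) ((σ ℤ.+ + 3 ℤ.* τ) ℤ.- (σ ℤ.- τ))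
           (trans (cong od (u≡v+4τ σ τ)) (isRes-shift 2 1 (σ ℤ.- τ) (τ ℤ.* + 2)))
           (isRes-at 4 0 0 τ 0<4 (u-v σ τ)))))
    where
    u≡v+4τ : ∀ σ τ → σ ℤ.+ + 3 ℤ.* τ ≡ (σ ℤ.- τ) ℤ.+ (τ ℤ.* + 2) ℤ.* + 2
    u≡v+4τ = solve-∀
    u-v : ∀ σ τ → (σ ℤ.+ + 3 ℤ.* τ) ℤ.- (σ ℤ.- τ) ≡ + 0 ℤ.+ τ ℤ.* + 4
    u-v = solve-∀

  halved-rotate₋ : ∀ j → halved j ≡ diagonal₋ (rotate₋ j)
  halved-rotate₋ (σ , τ) = trans (halved-parity σ τ) (trans (cong₂ _*_ (sym od-v) (rep-rotate₋ σ τ))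
    (sym (diagonal-value (σ ℤ.+ + 3 ℤ.* τ) (τ ℤ.- σ) ((σ ℤ.+ + 3 ℤ.* τ) ℤ.+ (τ ℤ.- σ))
           (trans (cong od (u≡-v+4τ σ τ)) (trans (isRes-shift 2 1 (σ ℤ.- τ) (τ ℤ.* + 2)) (sym od-v)))
           (isRes-at 4 0 0 τ 0<4 (u+v σ τ)))))
    where
    u≡-v+4τ : ∀ σ τ → σ ℤ.+ + 3 ℤ.* τ ≡ (σ ℤ.- τ) ℤ.+ (τ ℤ.* + 2) ℤ.* + 2
    u≡-v+4τ = solve-∀
    u+v : ∀ σ τ → (σ ℤ.+ + 3 ℤ.* τ) ℤ.+ (τ ℤ.- σ) ≡ + 0 ℤ.+ τ ℤ.* + 4
    u+v = solve-∀
    flip-sign : ∀ σ τ → τ ℤ.- σ ≡ ℤ.- (σ ℤ.- τ)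
    flip-sign = solve-∀
    od-v : od (τ ℤ.- σ) ≡ od (σ ℤ.- τ)
    od-v = trans (cong od (flip-sign σ τ)) (od-neg (σ ℤ.- τ))

  diagonal-box : ∀ u v c → c * rep u v ≢ 0 → In box (u , v)
  diagonal-box u v c nz = rep-box u v (nz*ʳ c (rep u v) nz)

  -- (σ , τ) ↦ (σ + 3τ , σ - τ) is a bijection onto {(u , v) : u ≡ v (mod 4)}.
  diagonal₊-sum : Σ□ diagonal₊ ≡ Σ□ halved
  diagonal₊-sum = sum-reindex box box diagonal₊ halved rotate₊ halved-rotate₊ inj onto
    (λ { (u , v) → diagonal-box u v (od u * od v * c0 (u ℤ.- v)) }) halved-box
    where
    sub : ∀ σ τ → (σ ℤ.+ + 3 ℤ.* τ) ℤ.- (σ ℤ.- τ) ≡ + 4 ℤ.* τ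
    sub = solve-∀
    recover : ∀ σ τ → σ ≡ (σ ℤ.- τ) ℤ.+ τ
    recover = solve-∀
    inj : ∀ j j' → rotate₊ j ≡ rotate₊ j' → j ≡ j'
    inj (σ , τ) (σ' , τ') e =
      cong₂ _,_ (trans (recover σ τ) (trans (cong₂ ℤ._+_ (cong proj₂ e) τ≡τ') (sym (recover σ' τ')))) τ≡τ'
      where τ≡τ' : τ ≡ τ'
            τ≡τ' = ℤP.*-cancelˡ-≡ (+ 4) τ τ'
                     (trans (sym (sub σ τ)) (trans (cong₂ ℤ._-_ (cong proj₁ e) (cong proj₂ e)) (sub σ' τ')))
    first : ∀ v k → (v ℤ.+ k) ℤ.+ + 3 ℤ.* k ≡ v ℤ.+ (+ 0 ℤ.+ k ℤ.* + 4)
    first = solve-∀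
    second : ∀ v k → (v ℤ.+ k) ℤ.- k ≡ v
    second = solve-∀
    restore : ∀ u v → v ℤ.+ (u ℤ.- v) ≡ u
    restore = solve-∀
    onto : ∀ i → diagonal₊ i ≢ 0 → Σ (ℤ × ℤ) λ j → rotate₊ j ≡ i
    onto (u , v) nz =
      let (k , ek) = isRes-onto 4 0 (u ℤ.- v) (nz*ʳ (od u * od v) _ (nz*ˡ _ (rep u v) nz))
      in (v ℤ.+ k , k) , cong₂ _,_ (trans (first v k) (trans (cong (λ t → v ℤ.+ t) ek) (restore u v))) (second v k)

  -- (σ , τ) ↦ (σ + 3τ , τ - σ) is a bijection onto {(u , v) : u ≡ -v (mod 4)}.
  diagonal₋-sum : Σ□ diagonal₋ ≡ Σ□ halved
  diagonal₋-sum = sum-reindex box box diagonal₋ halved rotate₋ halved-rotate₋ inj onto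
    (λ { (u , v) → diagonal-box u v (od u * od v * c0 (u ℤ.+ v)) }) halved-box
    where
    add : ∀ σ τ → (σ ℤ.+ + 3 ℤ.* τ) ℤ.+ (τ ℤ.- σ) ≡ + 4 ℤ.* τ
    add = solve-∀
    recover : ∀ σ τ → σ ≡ τ ℤ.- (τ ℤ.- σ)
    recover = solve-∀
    inj : ∀ j j' → rotate₋ j ≡ rotate₋ j' → j ≡ j'
    inj (σ , τ) (σ' , τ') e =
      cong₂ _,_ (trans (recover σ τ) (trans (cong₂ ℤ._-_ τ≡τ' (cong proj₂ e)) (sym (recover σ' τ')))) τ≡τ'
      where τ≡τ' : τ ≡ τ'
            τ≡τ' = ℤP.*-cancelˡ-≡ (+ 4) τ τ'
                     (trans (sym (add σ τ)) (trans (cong₂ ℤ._+_ (cong proj₁ e) (cong proj₂ e)) (add σ' τ')))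
    first : ∀ v k → (k ℤ.- v) ℤ.+ + 3 ℤ.* k ≡ (+ 0 ℤ.+ k ℤ.* + 4) ℤ.- v
    first = solve-∀
    second : ∀ v k → k ℤ.- (k ℤ.- v) ≡ v
    second = solve-∀
    restore : ∀ u v → (u ℤ.+ v) ℤ.- v ≡ u
    restore = solve-∀
    onto : ∀ i → diagonal₋ i ≢ 0 → Σ (ℤ × ℤ) λ j → rotate₋ j ≡ i
    onto (u , v) nz =
      let (k , ek) = isRes-onto 4 0 (u ℤ.+ v) (nz*ʳ (od u * od v) _ (nz*ˡ _ (rep u v) nz))
      in (k ℤ.- v , k) , cong₂ _,_ (trans (first v k) (trans (cong (ℤ._- v) ek) (restore u v))) (second v k)

  odd-split : Σ□ (restrict od od) ≡ Σ□ diagonal₊ + Σ□ diagonal₋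
  odd-split = trans (Σ□-ext (restrict od od) (λ i → diagonal₊ i + diagonal₋ i) pointwise) (Σ□-+ diagonal₊ diagonal₋)
    where
    pointwise : ∀ u v → od u * od v * rep u v ≡ diagonal₊ (u , v) + diagonal₋ (u , v)
    pointwise u v = sym (trans (sym (ℕP.*-distribʳ-+ (rep u v) (od u * od v * c0 (u ℤ.- v)) _))
                         (cong (_* rep u v) (trans (sym (ℕP.*-distribˡ-+ (od u * od v) _ _)) (odd-diagonals u v))))

  exchange : 2 * (Σ□ (restrict c0 c2) + Σ□ (restrict c2 c0)) ≡ Σ□ (restrict od od)
  exchange = begin
    2 * (Σ□ (restrict c0 c2) + Σ□ (restrict c2 c0))  ≡⟨ cong (2 *_) (trans (sym mixed-split) mixed-halve) ⟩
    2 * Σ□ halved                                     ≡⟨ cong (λ t → Σ□ halved + t) (ℕP.+-identityʳ (Σ□ halved)) ⟩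
    Σ□ halved + Σ□ halved                             ≡⟨ cong₂ _+_ diagonal₊-sum diagonal₋-sum ⟨
    Σ□ diagonal₊ + Σ□ diagonal₋                       ≡⟨ odd-split ⟨
    Σ□ (restrict od od)                               ∎
    where open ≡-Reasoning

ψψ-scalar : ∀ s j k → shift s (dil j (2 · ψ) ⊛ dil k (2 · ψ)) ≗ 4 · shift s (dil j ψ ⊛ dil k ψ)
ψψ-scalar s j k m = trans (shift-cong s both m) (shift-· s 4 (dil j ψ ⊛ dil k ψ) m)
  where
  open ≡-Reasoning
  both : dil j (2 · ψ) ⊛ dil k (2 · ψ) ≗ 4 · (dil j ψ ⊛ dil k ψ)
  both i = begin
    (dil j (2 · ψ) ⊛ dil k (2 · ψ)) i   ≡⟨ ⊛-cong (dil-· j 2 ψ) (dil-· k 2 ψ) i ⟩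
    (2 · dil j ψ ⊛ 2 · dil k ψ) i       ≡⟨ ⊛-·ˡ 2 (dil j ψ) (2 · dil k ψ) i ⟩
    2 * (dil j ψ ⊛ 2 · dil k ψ) i       ≡⟨ cong (2 *_) (⊛-·ʳ 2 (dil j ψ) (dil k ψ) i) ⟩
    2 * (2 * (dil j ψ ⊛ dil k ψ) i)     ≡⟨ ℕP.*-assoc 2 2 ((dil j ψ ⊛ dil k ψ) i) ⟨
    4 * (dil j ψ ⊛ dil k ψ) i           ∎

fψ-scalar : ∀ s f k → shift s (f ⊛ dil k (2 · ψ)) ≗ 2 · shift s (f ⊛ dil k ψ)
fψ-scalar s f k m = trans (shift-cong s (λ i → trans (⊛-cong {f} (λ _ → refl) (dil-· k 2 ψ) i) (⊛-·ʳ 2 f (dil k ψ) i)) m)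
                          (shift-· s 2 (f ⊛ dil k ψ) m)

nine : ∀ x₀ x₂ x₁ y₀ y₂ y₁ r → x₀ + x₂ + x₁ ≡ 1 → y₀ + y₂ + y₁ ≡ 1 →
  r ≡ (x₀ * y₀ * r + x₀ * y₂ * r + x₀ * y₁ * r) + (x₂ * y₀ * r + x₂ * y₂ * r + x₂ * y₁ * r)
      + (x₁ * y₀ * r + x₁ * y₂ * r + x₁ * y₁ * r)
nine x₀ x₂ x₁ y₀ y₂ y₁ r ex ey =
  sym (trans (expand x₀ x₂ x₁ y₀ y₂ y₁ r) (trans (cong₂ (λ a b → a * b * r) ex ey) (ℕP.+-identityʳ r)))
  where
  expand : ∀ x₀ x₂ x₁ y₀ y₂ y₁ r →
    (x₀ * y₀ * r + x₀ * y₂ * r + x₀ * y₁ * r) + (x₂ * y₀ * r + x₂ * y₂ * r + x₂ * y₁ * r)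
      + (x₁ * y₀ * r + x₁ * y₂ * r + x₁ * y₁ * r) ≡ (x₀ + x₂ + x₁) * (y₀ + y₂ + y₁) * r
  expand = ℕ-Ring.solve-∀

-- The final bookkeeping: the mixed classes add 2·t₅ to 4·t₅.
collect : ∀ t₁ t₂ t₃ t₄ t₅ t₆ t₇ w₀₂ w₂₀ → w₀₂ + w₂₀ ≡ 2 * t₅ →
  (t₁ + w₀₂ + 2 * t₄) + (w₂₀ + 4 * t₂ + 4 * t₇) + (2 * t₃ + 4 * t₆ + 4 * t₅) ≡
  t₁ + 4 * t₂ + 2 * t₃ + 2 * t₄ + 6 * t₅ + 4 * t₆ + 4 * t₇
collect t₁ t₂ t₃ t₄ t₅ t₆ t₇ w₀₂ w₂₀ e =
  trans (regroup t₁ t₂ t₃ t₄ t₅ t₆ t₇ w₀₂ w₂₀)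
    (trans (cong (λ w → t₁ + 4 * t₂ + 2 * t₃ + 2 * t₄ + 4 * t₅ + 4 * t₆ + 4 * t₇ + w) e)
           (finish t₁ t₂ t₃ t₄ t₅ t₆ t₇))
  where
  regroup : ∀ t₁ t₂ t₃ t₄ t₅ t₆ t₇ w₀₂ w₂₀ →
    (t₁ + w₀₂ + 2 * t₄) + (w₂₀ + 4 * t₂ + 4 * t₇) + (2 * t₃ + 4 * t₆ + 4 * t₅) ≡
    t₁ + 4 * t₂ + 2 * t₃ + 2 * t₄ + 4 * t₅ + 4 * t₆ + 4 * t₇ + (w₀₂ + w₂₀)
  regroup = ℕ-Ring.solve-∀
  finish : ∀ t₁ t₂ t₃ t₄ t₅ t₆ t₇ →
    t₁ + 4 * t₂ + 2 * t₃ + 2 * t₄ + 4 * t₅ + 4 * t₆ + 4 * t₇ + 2 * t₅ ≡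
    t₁ + 4 * t₂ + 2 * t₃ + 2 * t₄ + 6 * t₅ + 4 * t₆ + 4 * t₇
  finish = ℕ-Ring.solve-∀

module Terms (n : ℕ) where
  open Representations n public
  open Exchange n public

  class-term : ∀ X Y {F} → IsCount2 (energy X Y) F → Σ□ (restrict (member X) (member Y)) ≡ F n
  class-term X Y cF = trans (class-sum X Y) (sym (coefficient cF))

  representations : (dil 1 φ ⊛ dil 3 φ) n ≡ Σ□ (solutions λ a b → 1 * S a + 3 * S b)
  representations = coefficient (conv-count (dil-count 0 φ-count) (dil-count 2 φ-count))

  by-classes : Σ□ (solutions λ a b → 1 * S a + 3 * S b) ≡
    (Σ□ (restrict c0 c0) + Σ□ (restrict c0 c2) + Σ□ (restrict c0 od)) +
    (Σ□ (restrict c2 c0) + Σ□ (restrict c2 c2) + Σ□ (restrict c2 od)) +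
    (Σ□ (restrict od c0) + Σ□ (restrict od c2) + Σ□ (restrict od od))
  by-classes = trans (Σ□-ext _ (λ i → row c0 i + row c2 i + row od i)
      (λ a b → nine (c0 a) (c2 a) (od a) (c0 b) (c2 b) (od b) (rep a b) (partition a) (partition b)))
    (trans (Σ□-+3 (row c0) (row c2) (row od))
      (cong₂ _+_ (cong₂ _+_ (Σ□-+3 (restrict c0 c0) (restrict c0 c2) (restrict c0 od))
                            (Σ□-+3 (restrict c2 c0) (restrict c2 c2) (restrict c2 od)))
                 (Σ□-+3 (restrict od c0) (restrict od c2) (restrict od od))))
    where
    row : (ℤ → ℕ) → ℤ × ℤ → ℕ
    row cx i = restrict cx c0 i + restrict cx c2 i + restrict cx od i

  -- Each of seven class pairs is the coefficient of one product on the right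
  -- (for (odd , 0) and (2 , odd) the product lists its factors in reverse order).
  term₀₀ : Σ□ (restrict c0 c0) ≡ (dil 16 φ ⊛ dil 48 φ) n
  term₀₀ = class-term class0 class0 (conv-count (dil-count 15 φ-count) (dil-count 47 φ-count))

  term₂₂ : Σ□ (restrict c2 c2) ≡ 4 * shift 16 (dil 32 ψ ⊛ dil 96 ψ) n
  term₂₂ = trans (class-term class2 class2 (shift-count 16 (conv-count (dil-count 31 ψ-count) (dil-count 95 ψ-count))))
                 (ψψ-scalar 16 32 96 n)

  term₁₀ : Σ□ (restrict od c0) ≡ 2 * shift 1 (dil 48 φ ⊛ dil 8 ψ) n
  term₁₀ = trans (class-term classOdd class0
                   (count2-cong (λ z w → cong (λ t → 1 + t) (ℕP.+-comm (48 * S w) (8 * T z)))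
                     (count2-flip (shift-count 1 (conv-count (dil-count 47 φ-count) (dil-count 7 ψ-count))))))
                 (fψ-scalar 1 (dil 48 φ) 8 n)

  term₀₁ : Σ□ (restrict c0 od) ≡ 2 * shift 3 (dil 16 φ ⊛ dil 24 ψ) n
  term₀₁ = trans (class-term class0 classOdd (shift-count 3 (conv-count (dil-count 15 φ-count) (dil-count 23 ψ-count))))
                 (fψ-scalar 3 (dil 16 φ) 24 n)

  term₁₁ : Σ□ (restrict od od) ≡ 4 * shift 4 (dil 8 ψ ⊛ dil 24 ψ) n
  term₁₁ = trans (class-term classOdd classOdd (shift-count 4 (conv-count (dil-count 7 ψ-count) (dil-count 23 ψ-count))))
                 (ψψ-scalar 4 8 24 n)

  term₁₂ : Σ□ (restrict od c2) ≡ 4 * shift 13 (dil 8 ψ ⊛ dil 96 ψ) n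
  term₁₂ = trans (class-term classOdd class2 (shift-count 13 (conv-count (dil-count 7 ψ-count) (dil-count 95 ψ-count))))
                 (ψψ-scalar 13 8 96 n)

  term₂₁ : Σ□ (restrict c2 od) ≡ 4 * shift 7 (dil 24 ψ ⊛ dil 32 ψ) n
  term₂₁ = trans (class-term class2 classOdd
                   (count2-cong (λ z w → cong (λ t → 7 + t) (ℕP.+-comm (24 * T w) (32 * T z)))
                     (count2-flip (shift-count 7 (conv-count (dil-count 23 ψ-count) (dil-count 31 ψ-count))))))
                 (ψψ-scalar 7 24 32 n)

  term-mixed : Σ□ (restrict c0 c2) + Σ□ (restrict c2 c0) ≡ 2 * shift 4 (dil 8 ψ ⊛ dil 24 ψ) n
  term-mixed = ℕP.*-cancelˡ-≡ _ _ 2 (trans exchange (trans term₁₁ (ℕP.*-assoc 2 2 t₅)))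
    where t₅ = shift 4 (dil 8 ψ ⊛ dil 24 ψ) n

lemma2p3 : (n : ℕ) →
    (dil 1 φ ⊛ dil 3 φ) n ≡
      (dil 16 φ ⊛ dil 48 φ
        ⊕ 4 · shift 16 (dil 32 ψ ⊛ dil 96 ψ)
        ⊕ 2 · shift 1 (dil 48 φ ⊛ dil 8 ψ)
        ⊕ 2 · shift 3 (dil 16 φ ⊛ dil 24 ψ)
        ⊕ 6 · shift 4 (dil 8 ψ ⊛ dil 24 ψ)
        ⊕ 4 · shift 13 (dil 8 ψ ⊛ dil 96 ψ)
        ⊕ 4 · shift 7 (dil 24 ψ ⊛ dil 32 ψ)) n
lemma2p3 n = begin
  (dil 1 φ ⊛ dil 3 φ) n
    ≡⟨ trans representations by-classes ⟩
  (Σ□ (restrict c0 c0) + Σ□ (restrict c0 c2) + Σ□ (restrict c0 od)) +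
  (Σ□ (restrict c2 c0) + Σ□ (restrict c2 c2) + Σ□ (restrict c2 od)) +
  (Σ□ (restrict od c0) + Σ□ (restrict od c2) + Σ□ (restrict od od))
    ≡⟨ cong₂ _+_ (cong₂ _+_ (cong₂ _+_ (cong (_+ Σ□ (restrict c0 c2)) term₀₀) term₀₁)
                            (cong₂ _+_ (cong (λ t → Σ□ (restrict c2 c0) + t) term₂₂) term₂₁))
                 (cong₂ _+_ (cong₂ _+_ term₁₀ term₁₂) term₁₁) ⟩
  _ ≡⟨ collect ((dil 16 φ ⊛ dil 48 φ) n) (shift 16 (dil 32 ψ ⊛ dil 96 ψ) n) (shift 1 (dil 48 φ ⊛ dil 8 ψ) n)
               (shift 3 (dil 16 φ ⊛ dil 24 ψ) n) (shift 4 (dil 8 ψ ⊛ dil 24 ψ) n) (shift 13 (dil 8 ψ ⊛ dil 96 ψ) n)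
               (shift 7 (dil 24 ψ ⊛ dil 32 ψ) n) (Σ□ (restrict c0 c2)) (Σ□ (restrict c2 c0)) term-mixed ⟩
  _ ∎
  where
  open ≡-Reasoning
  open Terms n
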